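{- Let $k$ be a positive integer, $\alpha$ an integer with $(\alpha,k)=1$, and $p_1,p_2,p_3$ integers. Define \[ A(p_1,p_2,p_3;\alpha;k)=\sum_{x_1,x_2,x_3 \bmod k} e\Big(\frac{x_1x_2x_3\alpha-x_1p_1-x_2p_2-x_3p_3}{k}\Big), \] where $e(x)=e^{2\pi i x}$. Then \[ A(p_1,p_2,p_3;\alpha;k)=k\sum_{f\mid (p_2,p_3,k)} f\, S\Big(p_1\overline{\alpha},\frac{p_2p_3}{f^2};\frac kf\Big), \] where $S(m,n;r)$ is the classical Kloosterman sum modulo $r$ and $\overline\alpha$ denotes the inverse of $\alpha$ modulo $k/f$. -}

module Defs where

open import Level using (Level)
open import Data.Nat as ℕ using (ℕ; zero; suc; NonZero)
open import Data.Nat.Divisibility using (_∣_; _∣?_)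
open import Data.Integer as ℤ using (ℤ; +_; ∣_∣)
open import Data.Integer.DivMod using (_%ℕ_; _/ℕ_)
open import Data.Bool using (if_then_else_)
open import Data.Product using (_×_)
open import Relation.Nullary using (¬_)
open import Relation.Nullary.Decidable using (⌊_⌋; _×-dec_)
open import Data.Nat using (_≟_)
open import Algebra.Bundles using (CommutativeRing)

-- a mod r as a natural number in [0, r); convention: a mod 0 = 0 (never used)
modN : ℤ → ℕ → ℕ
modN a zero    = 0
modN a (suc r) = a %ℕ suc r

module Sums {c ℓ : Level} (R : CommutativeRing c ℓ) where
  open CommutativeRing R hiding (Carrier; _≈_)
  open CommutativeRing R public using (Carrier; _≈_)

  pow : Carrier → ℕ → Carrier
  pow x zero    = 1#
  pow x (suc n) = x * pow x n

  scal : ℕ → Carrier → Carrier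
  scal zero    x = 0#
  scal (suc n) x = x + scal n x

  sumTo : ℕ → (ℕ → Carrier) → Carrier
  sumTo zero    g = 0#
  sumTo (suc n) g = sumTo n g + g n

  -- additive character modulo r given by the root η of order r:  e(a / r) := η^(a mod r)
  ex : Carrier → ℕ → ℤ → Carrier
  ex η r a = pow η (modN a r)

  Kloosterman : Carrier → ℤ → ℤ → ℕ → Carrier
  Kloosterman η m n r =
    sumTo r λ x → sumTo r λ y →
      if ⌊ modN (+ (x ℕ.* y)) r ≟ modN (ℤ.+ 1) r ⌋
      then ex η r (m ℤ.* + x ℤ.+ n ℤ.* + y)
      else 0#

  -- A(p1,p2,p3;α;k) = Σ_{x1,x2,x3 mod k} e((x1 x2 x3 α - x1 p1 - x2 p2 - x3 p3)/k),  ζ = e(1/k)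
  Asum : Carrier → ℤ → ℤ → ℤ → ℤ → ℕ → Carrier
  Asum ζ p₁ p₂ p₃ α k =
    sumTo k λ x₁ → sumTo k λ x₂ → sumTo k λ x₃ →
      ex ζ k (+ x₁ ℤ.* + x₂ ℤ.* + x₃ ℤ.* α ℤ.- + x₁ ℤ.* p₁ ℤ.- + x₂ ℤ.* p₂ ℤ.- + x₃ ℤ.* p₃)

  -- k Σ_{f | (p2,p3,k)} f S(p1 ᾱ_f, p2 p3 / f²; k/f), where f = suc i ranges over 1..k,
  -- e(·/(k/f)) is realised by ζ^f, and ᾱ_f = abar f is the chosen inverse of α mod k/f
  RHS : Carrier → ℤ → ℤ → ℤ → (ℕ → ℤ) → ℕ → Carrier
  RHS ζ p₁ p₂ p₃ abar k =
    scal k (sumTo k λ i →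
      if ⌊ (suc i ∣? ∣ p₂ ∣) ×-dec ((suc i ∣? ∣ p₃ ∣) ×-dec (suc i ∣? k)) ⌋
      then scal (suc i)
             (Kloosterman (pow ζ (suc i)) (p₁ ℤ.* abar (suc i))
                          ((p₂ ℤ.* p₃) /ℕ (suc i ℕ.* suc i)) (k ℕ./ suc i))
      else 0#)

  -- standing hypotheses making (R, ζ) a faithful stand-in for (ℂ, e(1/k))
  NoZeroDivisors : Set _
  NoZeroDivisors = ∀ x y → x * y ≈ 0# → x ≈ 0# Data.Sum.⊎ y ≈ 0#
    where import Data.Sum

  CharZero : Set _
  CharZero = ∀ n → ¬ (scal (suc n) 1#) ≈ 0#

  PrimitiveRoot : Carrier → ℕ → Set _
  PrimitiveRoot ζ k = pow ζ k ≈ 1# × (∀ j → 0 ℕ.< j → j ℕ.< k → ¬ pow ζ j ≈ 1#)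

{-# OPTIONS --safe #-}
-- Summing over x₃ first, orthogonality of the additive characters modulo k turns A into k times the
-- sum of e(−(x₁p₁ + x₂p₂)/k) over the solutions of x₁x₂α ≡ p₃ (mod k). These solutions are
-- parametrised bijectively by a divisor f = gcd(x₁, k) of (p₃, k), a pair x, y of mutually inverse
-- residues modulo r = k/f, and j mod f, through x₁ ≡ −f ᾱ x and x₂ ≡ −(p₃/f) y + j r (mod k).
-- In these coordinates the summand is e((f ᾱ x p₁ + (p₃/f) y p₂)/k) · e(−j p₂/f); the first factor is
-- the Kloosterman summand modulo r once f divides p₂, and the sum over j is f or 0 according as f
-- divides p₂ or not. Orthogonality only uses a primitive k-th root of unity ζ in a commutative ring
-- without zero divisors, so e(a/k) may be read as ζ^a in any such ring.
module Submission where

open import Defs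
open import Level using (Level)
open import Algebra.Bundles using (CommutativeRing)
open import Data.Bool using (if_then_else_)
open import Data.Empty using (⊥-elim)
open import Data.List.Base using ([]; _∷_)
open import Data.Product using (Σ; _,_; proj₁; proj₂)
open import Data.Sum using (inj₁; inj₂)
open import Data.Nat as ℕ using (ℕ; zero; suc; NonZero; _/_)
import Data.Nat.Properties as ℕ
import Data.Nat.DivMod as ℕ
open import Data.Nat.Divisibility using (_∣_; _∣?_; divides)
open import Data.Nat.Coprimality using (Coprime)
open import Data.Nat.GCD using (module Bézout)
import Data.Nat.Tactic.RingSolver as ℕ-Tactic
open import Data.Integer as ℤ using (ℤ; ∣_∣; +_; -[1+_])
import Data.Integer.Properties as ℤ
import Data.Integer.Divisibility.Signed as ℤ
open import Data.Integer.DivMod using (_/ℕ_; a≡a%ℕn+[a/ℕn]*n; n%ℕd<d)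
import Data.Integer.Solver as ℤ-Solver
import Data.Integer.Tactic.RingSolver as ℤ-Tactic
open import Relation.Nullary using (Dec; yes; no; ¬_)
open import Relation.Nullary.Decidable using (⌊_⌋; _×-dec_; map′)
open import Relation.Binary.Definitions using (tri<; tri≈; tri>)
open import Relation.Binary.PropositionalEquality as ≡ using (_≡_; _≢_)
open import Relation.Binary.Bundles using (Setoid)
open import Relation.Binary.Structures using (IsEquivalence)

module Congruence where

  open import Data.Integer using (_+_; _*_; -_; _-_)
  open ≡
  open ℤ-Solver.+-*-Solver using (solve; _:=_; _:+_; _:-_; _:*_; :-_; con)

  infix 4 _≡_mod_

  record _≡_mod_ (a b : ℤ) (n : ℕ) : Set where
    constructor congruent
    field
      quotient : ℤ
      equation : a ≡ b + quotient * + n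

  module _ {n : ℕ} where

    ≡mod-reflexive : ∀ {a b} → a ≡ b → a ≡ b mod n
    ≡mod-reflexive {a} refl = congruent (+ 0) (solve 2 (λ a n → a := a :+ con (+ 0) :* n) refl a (+ n))

    ≡mod-refl : ∀ {a} → a ≡ a mod n
    ≡mod-refl = ≡mod-reflexive refl

    ≡mod-sym : ∀ {a b} → a ≡ b mod n → b ≡ a mod n
    ≡mod-sym {b = b} (congruent q refl) =
      congruent (- q) (solve 3 (λ b q n → b := (b :+ q :* n) :+ (:- q) :* n) refl b q (+ n))

    ≡mod-trans : ∀ {a b c} → a ≡ b mod n → b ≡ c mod n → a ≡ c mod n
    ≡mod-trans {c = c} (congruent q refl) (congruent q′ refl) =
      congruent (q′ + q) (solve 4 (λ c q q′ n → (c :+ q′ :* n) :+ q :* n := c :+ (q′ :+ q) :* n)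
                                  refl c q q′ (+ n))

    ≡mod-isEquivalence : IsEquivalence (λ a b → a ≡ b mod n)
    ≡mod-isEquivalence = record { refl = ≡mod-refl ; sym = ≡mod-sym ; trans = ≡mod-trans }

    +-cong-mod : ∀ {a b c d} → a ≡ b mod n → c ≡ d mod n → a + c ≡ b + d mod n
    +-cong-mod {b = b} {d = d} (congruent q refl) (congruent q′ refl) =
      congruent (q + q′) (solve 5 (λ b d q q′ n → (b :+ q :* n) :+ (d :+ q′ :* n)
                                               := (b :+ d) :+ (q :+ q′) :* n)
                                  refl b d q q′ (+ n))

    -‿cong-mod : ∀ {a b} → a ≡ b mod n → - a ≡ - b mod n
    -‿cong-mod {b = b} (congruent q refl) =
      congruent (- q) (solve 3 (λ b q n → :- (b :+ q :* n) := :- b :+ (:- q) :* n) refl b q (+ n))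

    *-congˡ-mod : ∀ c {a b} → a ≡ b mod n → c * a ≡ c * b mod n
    *-congˡ-mod c {b = b} (congruent q refl) =
      congruent (c * q) (solve 4 (λ b c q n → c :* (b :+ q :* n) := c :* b :+ (c :* q) :* n) refl b c q (+ n))

    *-congʳ-mod : ∀ c {a b} → a ≡ b mod n → a * c ≡ b * c mod n
    *-congʳ-mod c {a} {b} a≡b = subst₂ (_≡_mod n) (ℤ.*-comm c a) (ℤ.*-comm c b) (*-congˡ-mod c a≡b)

    *-cong-mod : ∀ {a b c d} → a ≡ b mod n → c ≡ d mod n → a * c ≡ b * d mod n
    *-cong-mod {b = b} {c} a≡b c≡d = ≡mod-trans (*-congʳ-mod c a≡b) (*-congˡ-mod b c≡d)

    *n≡0-mod : ∀ q → q * + n ≡ + 0 mod n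
    *n≡0-mod q = congruent q (solve 2 (λ q n → q :* n := con (+ 0) :+ q :* n) refl q (+ n))

  ≡mod-setoid : ℕ → Setoid _ _
  ≡mod-setoid n = record { isEquivalence = ≡mod-isEquivalence {n} }

  module ≡mod-Reasoning (n : ℕ) where
    open import Relation.Binary.Reasoning.Setoid (≡mod-setoid n) public

  scale-mod : ∀ m {n a b} → a ≡ b mod n → + m * a ≡ + m * b mod (m ℕ.* n)
  scale-mod m {n} {b = b} (congruent q refl) = congruent q (begin
    + m * (b + q * + n)
      ≡⟨ solve 4 (λ m b q n → m :* (b :+ q :* n) := m :* b :+ q :* (m :* n)) refl (+ m) b q (+ n) ⟩
    + m * b + q * (+ m * + n)
      ≡⟨ cong (λ t → + m * b + q * t) (ℤ.pos-* m n) ⟨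
    + m * b + q * + (m ℕ.* n)    ∎)
    where open ≡-Reasoning

  *-cancelˡ-mod : ∀ m .{{_ : NonZero m}} {n a b} → + m * a ≡ + m * b mod (m ℕ.* n) → a ≡ b mod n
  *-cancelˡ-mod m {n} {a} {b} (congruent q eq) = congruent q (ℤ.*-cancelˡ-≡ (+ m) a (b + q * + n) (begin
    + m * a                        ≡⟨ eq ⟩
    + m * b + q * + (m ℕ.* n)      ≡⟨ cong (λ t → + m * b + q * t) (ℤ.pos-* m n) ⟩
    + m * b + q * (+ m * + n)
      ≡⟨ solve 4 (λ m b q n → m :* b :+ q :* (m :* n) := m :* (b :+ q :* n)) refl (+ m) b q (+ n) ⟩
    + m * (b + q * + n)            ∎))
    where open ≡-Reasoning

  ≡mod-∣ : ∀ {d n a b} → d ∣ n → a ≡ b mod n → a ≡ b mod d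
  ≡mod-∣ {d} {b = b} (divides m refl) (congruent q refl) = congruent (q * + m) (begin
    b + q * + (m ℕ.* d)      ≡⟨ cong (λ t → b + q * t) (ℤ.pos-* m d) ⟩
    b + q * (+ m * + d)
      ≡⟨ solve 4 (λ b q m d → b :+ q :* (m :* d) := b :+ (q :* m) :* d) refl b q (+ m) (+ d) ⟩
    b + q * + m * + d        ∎)
    where open ≡-Reasoning

  private
    multiple≤ : ∀ {n r s} t → + r ≡ + s + + suc t * + n → n ℕ.≤ r
    multiple≤ {n} {r} {s} t eq
      with ℤ.+-injective (trans eq (sym (trans (ℤ.pos-+ s _) (cong (λ m → + s + m) (ℤ.pos-* (suc t) n)))))
    ... | refl = ℕ.≤-trans (ℕ.m≤m+n n (t ℕ.* n)) (ℕ.m≤n+m _ s)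

  <-mod-injective : ∀ {n r s} → r ℕ.< n → s ℕ.< n → + r ≡ + s mod n → r ≡ s
  <-mod-injective {s = s} _ _ (congruent (+ zero) eq) = ℤ.+-injective (trans eq (ℤ.+-identityʳ (+ s)))
  <-mod-injective r<n _ (congruent (+ suc t) eq) = ⊥-elim (ℕ.<⇒≱ r<n (multiple≤ t eq))
  <-mod-injective {n} {r} {s} _ s<n (congruent -[1+ t ] eq) = ⊥-elim (ℕ.<⇒≱ s<n (multiple≤ t eq′))
    where
    eq′ : + s ≡ + r + + suc t * + n
    eq′ = trans (solve 3 (λ s t n → s := (s :+ (:- t) :* n) :+ t :* n) refl (+ s) (+ suc t) (+ n))
                (cong (_+ + suc t * + n) (sym eq))

  modN-< : ∀ a n .{{_ : NonZero n}} → modN a n ℕ.< n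
  modN-< a (suc n) = n%ℕd<d a (suc n)

  modN≡mod : ∀ a n .{{_ : NonZero n}} → + modN a n ≡ a mod n
  modN≡mod a (suc n) = ≡mod-sym (congruent (a /ℕ suc n) (a≡a%ℕn+[a/ℕn]*n a (suc n)))

  module _ {n : ℕ} .{{_ : NonZero n}} where

    ≡mod⇒modN≡ : ∀ {a b} → a ≡ b mod n → modN a n ≡ modN b n
    ≡mod⇒modN≡ {a} {b} a≡b = <-mod-injective (modN-< a n) (modN-< b n)
      (≡mod-trans (modN≡mod a n) (≡mod-trans a≡b (≡mod-sym (modN≡mod b n))))

    modN≡⇒≡mod : ∀ {a b} → modN a n ≡ modN b n → a ≡ b mod n
    modN≡⇒≡mod {a} {b} eq =
      ≡mod-trans (≡mod-sym (modN≡mod a n)) (≡mod-trans (≡mod-reflexive (cong +_ eq)) (modN≡mod b n))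

    modN-of-< : ∀ {m} → m ℕ.< n → modN (+ m) n ≡ m
    modN-of-< {m} m<n = <-mod-injective (modN-< (+ m) n) m<n (modN≡mod (+ m) n)

    ≡modN⇒≡mod : ∀ {x a} → x ≡ modN a n → + x ≡ a mod n
    ≡modN⇒≡mod {a = a} refl = modN≡mod a n

    ≡mod⇒≡modN : ∀ {x a} → x ℕ.< n → + x ≡ a mod n → x ≡ modN a n
    ≡mod⇒≡modN x<n x≡a = trans (sym (modN-of-< x<n)) (≡mod⇒modN≡ x≡a)

  module _ {n : ℕ} where

    a+q*n≡a-mod : ∀ a q → a + q * + n ≡ a mod n
    a+q*n≡a-mod a q = congruent q refl

    +-cancelˡ-mod : ∀ c {a b} → c + a ≡ c + b mod n → a ≡ b mod n
    +-cancelˡ-mod c {a} {b} c+a≡c+b =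
      subst₂ (_≡_mod n) (cancel a) (cancel b) (+-cong-mod (≡mod-refl {a = - c}) c+a≡c+b)
      where
      cancel : ∀ a → - c + (c + a) ≡ a
      cancel a = solve 2 (λ c a → :- c :+ (c :+ a) := a) refl c a

    *-inverse-unique : ∀ {x y y′} → x * y ≡ + 1 mod n → x * y′ ≡ + 1 mod n → y ≡ y′ mod n
    *-inverse-unique {x} {y} {y′} xy≡1 xy′≡1 = begin
      y               ≡⟨ solve 1 (λ y → y := con (+ 1) :* y) refl y ⟩
      + 1 * y         ≈⟨ *-congʳ-mod y (≡mod-sym xy′≡1) ⟩
      x * y′ * y      ≡⟨ solve 3 (λ x y y′ → x :* y′ :* y := x :* y :* y′) refl x y y′ ⟩
      x * y * y′      ≈⟨ *-congʳ-mod y′ xy≡1 ⟩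
      + 1 * y′        ≡⟨ solve 1 (λ y → con (+ 1) :* y := y) refl y′ ⟩
      y′              ∎
      where open ≡mod-Reasoning n

  ∣⇒≡0-mod : ∀ {d} c → d ∣ ∣ c ∣ → c ≡ + 0 mod d
  ∣⇒≡0-mod {d} c d∣c with ℤ.∣ᵤ⇒∣ {+ d} {c} d∣c
  ... | ℤ.divides q eq = congruent q (trans eq (sym (ℤ.+-identityˡ _)))

  ≡0-mod⇒∣ : ∀ {d} c → c ≡ + 0 mod d → d ∣ ∣ c ∣
  ≡0-mod⇒∣ {d} c (congruent q eq) = ℤ.∣⇒∣ᵤ {+ d} (ℤ.divides q (trans eq (ℤ.+-identityˡ _)))

  ∣[a-b]⇒≡mod : ∀ {n} a b → n ∣ ∣ a - b ∣ → a ≡ b mod n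
  ∣[a-b]⇒≡mod {n} a b n∣a-b =
    subst₂ (_≡_mod n) (solve 2 (λ a b → (a :- b) :+ b := a) refl a b) (ℤ.+-identityˡ b)
           (+-cong-mod (∣⇒≡0-mod (a - b) n∣a-b) (≡mod-refl {a = b}))

  ≡mod⇒∣[a-b] : ∀ {n} a b → a ≡ b mod n → n ∣ ∣ a - b ∣
  ≡mod⇒∣[a-b] {n} a b a≡b =
    ≡0-mod⇒∣ (a - b) (subst (λ z → a - b ≡ z mod n) (ℤ.+-inverseʳ b)
                             (+-cong-mod a≡b (≡mod-refl {a = - b})))

  ∣⇒≡/ℕ* : ∀ {d} .{{_ : NonZero d}} a → d ∣ ∣ a ∣ → a ≡ (a /ℕ d) * + d
  ∣⇒≡/ℕ* {suc d} a d∣a = begin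
    a                                           ≡⟨ a≡a%ℕn+[a/ℕn]*n a (suc d) ⟩
    + modN a (suc d) + (a /ℕ suc d) * + suc d   ≡⟨ cong (λ t → + t + (a /ℕ suc d) * + suc d) a%d≡0 ⟩
    + 0 + (a /ℕ suc d) * + suc d                ≡⟨ ℤ.+-identityˡ _ ⟩
    (a /ℕ suc d) * + suc d                      ∎
    where
    open ≡-Reasoning
    a%d≡0 : modN a (suc d) ≡ 0
    a%d≡0 = ≡mod⇒modN≡ (∣⇒≡0-mod a d∣a)

  */ℕ-cancel : ∀ {d} .{{_ : NonZero d}} z → (z * + d) /ℕ d ≡ z
  */ℕ-cancel {d} z = sym (ℤ.*-cancelʳ-≡ z ((z * + d) /ℕ d) (+ d)
    (∣⇒≡/ℕ* (z * + d) (≡0-mod⇒∣ (z * + d) (*n≡0-mod z))))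

  bézout-inverse : ∀ {f r u} .{{_ : NonZero f}} → Bézout.Identity f (u ℕ.* f) (f ℕ.* r) →
                   Σ ℤ λ v → + u * v ≡ + 1 mod r
  bézout-inverse {f} {r} {u} (Bézout.+- a b eq) = + a , congruent (+ b) (begin
    + u * + a          ≡⟨ ℤ.pos-* u a ⟨
    + (u ℕ.* a)        ≡⟨ cong +_ 1+br≡ua ⟨
    + 1 + + (b ℕ.* r)  ≡⟨ cong (λ n → + 1 + n) (ℤ.pos-* b r) ⟩
    + 1 + + b * + r    ∎)
    where
    open ≡-Reasoning
    1+br≡ua : 1 ℕ.+ b ℕ.* r ≡ u ℕ.* a
    1+br≡ua = ℕ.*-cancelʳ-≡ _ _ f (begin
      (1 ℕ.+ b ℕ.* r) ℕ.* f  ≡⟨ ℕ-Tactic.solve (b ∷ r ∷ f ∷ []) ⟩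
      f ℕ.+ b ℕ.* (f ℕ.* r)  ≡⟨ eq ⟩
      a ℕ.* (u ℕ.* f)        ≡⟨ ℕ-Tactic.solve (a ∷ u ∷ f ∷ []) ⟩
      (u ℕ.* a) ℕ.* f        ∎)
  bézout-inverse {f} {r} {u} (Bézout.-+ a b eq) = - + a , congruent (- + b) (begin
    + u * - + a
      ≡⟨ solve 2 (λ u a → u :* :- a := con (+ 1) :+ :- (con (+ 1) :+ a :* u)) refl (+ u) (+ a) ⟩
    + 1 + - (+ 1 + + a * + u)
      ≡⟨ cong (λ n → + 1 + - n) 1+au≡br ⟩
    + 1 + - (+ b * + r)
      ≡⟨ cong (λ n → + 1 + n) (ℤ.neg-distribˡ-* (+ b) (+ r)) ⟩
    + 1 + - + b * + r
      ∎)
    where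
    open ≡-Reasoning
    1+au≡br : + 1 + + a * + u ≡ + b * + r
    1+au≡br = begin
      + 1 + + a * + u        ≡⟨ cong (λ n → + 1 + n) (ℤ.pos-* a u) ⟨
      + (1 ℕ.+ a ℕ.* u)      ≡⟨ cong +_ (ℕ.*-cancelʳ-≡ _ _ f (begin
        (1 ℕ.+ a ℕ.* u) ℕ.* f  ≡⟨ ℕ-Tactic.solve (a ∷ u ∷ f ∷ []) ⟩
        f ℕ.+ a ℕ.* (u ℕ.* f)  ≡⟨ eq ⟩
        b ℕ.* (f ℕ.* r)        ≡⟨ ℕ-Tactic.solve (b ∷ f ∷ r ∷ []) ⟩
        (b ℕ.* r) ℕ.* f        ∎)) ⟩
      + (b ℕ.* r)            ≡⟨ ℤ.pos-* b r ⟩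
      + b * + r              ∎

open Congruence

-- Divisors of k are indexed as f = suc i, as in RHS, with cofactor r = k / f.
module Parametrisation (k : ℕ) .{{_ : NonZero k}} (α p₃ : ℤ) (ᾱ : ℕ → ℤ)
                       (ᾱ-inverse : ∀ i → suc i ∣ k →
                          modN (α ℤ.* ᾱ (suc i)) (k / suc i) ≡ modN (+ 1) (k / suc i)) where

  open import Data.Integer using (_+_; _*_; -_; _-_)
  open import Data.Product using (_×_)
  open import Data.Nat.GCD using (gcd; gcd-GCD; gcd[m,n]∣m; gcd[m,n]∣n)
  open import Data.Nat.Divisibility using (∣-antisym; 0∣⇒≡0; ∣⇒≤)
  open ℤ-Solver.+-*-Solver using (solve; _:=_; _:+_; _:*_; :-_; con)
  open ≡

  Solution : ℕ → ℕ → Set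
  Solution x₁ x₂ = k ∣ ∣ + x₁ * + x₂ * α - p₃ ∣

  Solution⇒≡mod : ∀ {x₁ x₂} → Solution x₁ x₂ → + x₁ * + x₂ * α ≡ p₃ mod k
  Solution⇒≡mod = ∣[a-b]⇒≡mod _ p₃

  ≡mod⇒Solution : ∀ {x₁ x₂} → + x₁ * + x₂ * α ≡ p₃ mod k → Solution x₁ x₂
  ≡mod⇒Solution = ≡mod⇒∣[a-b] _ p₃

  x₁-coord : ℕ → ℤ → ℤ
  x₁-coord i x = - (+ suc i * ᾱ (suc i) * x)

  x₂-coord : ℕ → ℤ → ℤ → ℤ
  x₂-coord i y j = - (p₃ /ℕ suc i * y) + j * + (k / suc i)

  φ₁ : ℕ → ℕ → ℕ
  φ₁ i x = modN (x₁-coord i (+ x)) k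

  φ₂ : ℕ → ℕ → ℕ → ℕ
  φ₂ i y j = modN (x₂-coord i (+ y) (+ j)) k

  Admissible : ℕ → Set
  Admissible i = (suc i ∣ ∣ p₃ ∣) × (suc i ∣ k)

  admissible? : ∀ i → Dec (Admissible i)
  admissible? i = (suc i ∣? ∣ p₃ ∣) ×-dec (suc i ∣? k)

  Inverses : ℕ → ℕ → ℕ → Set
  Inverses i x y = modN (+ (x ℕ.* y)) (k / suc i) ≡ modN (+ 1) (k / suc i)

  inverses? : ∀ i x y → Dec (Inverses i x y)
  inverses? i x y = modN (+ (x ℕ.* y)) (k / suc i) ℕ.≟ modN (+ 1) (k / suc i)

  record Parametrises (i x y j x₁ x₂ : ℕ) : Set where
    constructor parametrisation
    field
      admissible : Admissible i
      inverses   : Inverses i x y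
      x₁≡φ₁      : x₁ ≡ φ₁ i x
      x₂≡φ₂      : x₂ ≡ φ₂ i y j

  parametrises? : ∀ i x y j x₁ x₂ → Dec (Parametrises i x y j x₁ x₂)
  parametrises? i x y j x₁ x₂ =
    map′ (λ (a , b , c , d) → parametrisation a b c d) (λ (parametrisation a b c d) → a , b , c , d)
         (admissible? i ×-dec inverses? i x y ×-dec (x₁ ℕ.≟ φ₁ i x) ×-dec (x₂ ℕ.≟ φ₂ i y j))

  record Preimage (x₁ x₂ : ℕ) : Set where
    field
      i x y j      : ℕ
      i<k          : i ℕ.< k
      x<r          : x ℕ.< k / suc i
      y<r          : y ℕ.< k / suc i
      j<f          : j ℕ.< suc i
      parametrises : Parametrises i x y j x₁ x₂

  module Divisor {i : ℕ} (f∣k : suc i ∣ k) where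

    f r : ℕ
    f = suc i
    r = k / f

    k≡f*r : k ≡ f ℕ.* r
    k≡f*r = sym (ℕ.m*[n/m]≡n f∣k)

    instance
      r≢0 : NonZero r
      r≢0 = ℕ.≢-nonZero λ r≡0 →
        ℕ.≢-nonZero⁻¹ k (trans k≡f*r (trans (cong (f ℕ.*_) r≡0) (ℕ.*-zeroʳ f)))

    f·r≡k : + f * + r ≡ + k
    f·r≡k = trans (sym (ℤ.pos-* f r)) (cong +_ (sym k≡f*r))

    ā q₃ : ℤ
    ā = ᾱ f
    q₃ = p₃ /ℕ f

    αā≡1 : α * ā ≡ + 1 mod r
    αā≡1 = modN≡⇒≡mod (ᾱ-inverse i f∣k)

    mod-k⇒mod-f : ∀ {a b} → a ≡ b mod k → a ≡ b mod f
    mod-k⇒mod-f = ≡mod-∣ f∣k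

    scale-mod-k : ∀ {a b} → a ≡ b mod r → + f * a ≡ + f * b mod k
    scale-mod-k a≡b = subst (_ ≡ _ mod_) (sym k≡f*r) (scale-mod f a≡b)

    cancel-mod-k : ∀ {a b} → + f * a ≡ + f * b mod k → a ≡ b mod r
    cancel-mod-k fa≡fb = *-cancelˡ-mod f (subst (_ ≡ _ mod_) k≡f*r fa≡fb)

    q₃*f≡p₃ : f ∣ ∣ p₃ ∣ → q₃ * + f ≡ p₃
    q₃*f≡p₃ f∣p₃ = sym (∣⇒≡/ℕ* p₃ f∣p₃)

    coords-solution : ∀ {x y j x₁ x₂} → f ∣ ∣ p₃ ∣ → x * y ≡ + 1 mod r →
                      x₁ ≡ x₁-coord i x mod k → x₂ ≡ x₂-coord i y j mod k →
                      x₁ * x₂ * α ≡ p₃ mod k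
    coords-solution {x} {y} {j} {x₁} {x₂} f∣p₃ xy≡1 x₁≡ x₂≡ = begin
      x₁ * x₂ * α                                               ≈⟨ *-congʳ-mod α x₁x₂≡ ⟩
      - (+ f * ā * x) * (- (q₃ * y) + j * + r) * α              ≡⟨ expand ⟩
      q₃ * (+ f * (α * ā * (x * y))) + - (ā * x * α * j) * + k  ≈⟨ a+q*n≡a-mod _ (- (ā * x * α * j)) ⟩
      q₃ * (+ f * (α * ā * (x * y)))                            ≈⟨ *-congˡ-mod q₃ f·αāxy≡f ⟩
      q₃ * (+ f * + 1)                                          ≡⟨ cong (q₃ *_) (ℤ.*-identityʳ (+ f)) ⟩
      q₃ * + f                                                  ≡⟨ q₃*f≡p₃ f∣p₃ ⟩
      p₃                                                        ∎
      where
      open ≡mod-Reasoning k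
      x₁x₂≡ : x₁ * x₂ ≡ x₁-coord i x * x₂-coord i y j mod k
      x₁x₂≡ = *-cong-mod x₁≡ x₂≡
      f·αāxy≡f : + f * (α * ā * (x * y)) ≡ + f * + 1 mod k
      f·αāxy≡f = scale-mod-k (*-cong-mod αā≡1 xy≡1)
      expand : - (+ f * ā * x) * (- (q₃ * y) + j * + r) * α ≡
               q₃ * (+ f * (α * ā * (x * y))) + - (ā * x * α * j) * + k
      expand = trans (solve 8 (λ f ā x q₃ y j r α →
                                 :- (f :* ā :* x) :* (:- (q₃ :* y) :+ j :* r) :* α
                              := q₃ :* (f :* (α :* ā :* (x :* y))) :+ :- (ā :* x :* α :* j) :* (f :* r))
                              refl (+ f) ā x q₃ y j (+ r) α)
                     (cong (λ n → q₃ * (+ f * (α * ā * (x * y))) + - (ā * x * α * j) * n) f·r≡k)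

    xy≡1-mod-r : ∀ {x y} → modN (+ (x ℕ.* y)) r ≡ modN (+ 1) r → + x * + y ≡ + 1 mod r
    xy≡1-mod-r {x} {y} eq = ≡mod-trans (≡mod-reflexive (sym (ℤ.pos-* x y))) (modN≡⇒≡mod eq)

    x₁-coord≡0-mod-f : ∀ {x x₁} → x₁ ≡ x₁-coord i x mod k → x₁ ≡ + 0 mod f
    x₁-coord≡0-mod-f {x} x₁≡ = ≡mod-trans (mod-k⇒mod-f x₁≡) (≡mod-trans
      (≡mod-reflexive (solve 3 (λ f ā x → :- (f :* ā :* x) := :- (ā :* x) :* f) refl (+ f) ā x))
      (*n≡0-mod (- (ā * x))))

    f≡x₁*[-αy] : ∀ {x y x₁} → x * y ≡ + 1 mod r → x₁ ≡ x₁-coord i x mod k →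
                 + f ≡ x₁ * - (α * y) mod k
    f≡x₁*[-αy] {x} {y} {x₁} xy≡1 x₁≡ = ≡mod-sym (begin
      x₁ * - (α * y)                ≈⟨ *-congʳ-mod (- (α * y)) x₁≡ ⟩
      - (+ f * ā * x) * - (α * y)   ≡⟨ solve 5 (λ f ā x α y → :- (f :* ā :* x) :* :- (α :* y)
                                                           := f :* (α :* ā :* (x :* y)))
                                               refl (+ f) ā x α y ⟩
      + f * (α * ā * (x * y))       ≈⟨ scale-mod-k (*-cong-mod αā≡1 xy≡1) ⟩
      + f * + 1                     ≡⟨ ℤ.*-identityʳ (+ f) ⟩
      + f                           ∎)
      where open ≡mod-Reasoning k

    x₁-coord-injective : ∀ {x x′} → x₁-coord i x ≡ x₁-coord i x′ mod k → x ≡ x′ mod r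
    x₁-coord-injective {x} {x′} eq = begin
      x               ≡⟨ solve 1 (λ x → x := con (+ 1) :* x) refl x ⟩
      + 1 * x         ≈⟨ *-congʳ-mod x (≡mod-sym αā≡1) ⟩
      α * ā * x       ≡⟨ ℤ.*-assoc α ā x ⟩
      α * (ā * x)     ≈⟨ *-congˡ-mod α āx≡āx′ ⟩
      α * (ā * x′)    ≡⟨ ℤ.*-assoc α ā x′ ⟨
      α * ā * x′      ≈⟨ *-congʳ-mod x′ αā≡1 ⟩
      + 1 * x′        ≡⟨ solve 1 (λ x → con (+ 1) :* x := x) refl x′ ⟩
      x′              ∎
      where
      open ≡mod-Reasoning r
      untangle : ∀ x → - x₁-coord i x ≡ + f * (ā * x)
      untangle x = trans (ℤ.neg-involutive _) (ℤ.*-assoc (+ f) ā x)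
      āx≡āx′ : ā * x ≡ ā * x′ mod r
      āx≡āx′ = cancel-mod-k (subst₂ (_≡_mod k) (untangle x) (untangle x′) (-‿cong-mod eq))

    x₂-coord-injective : ∀ {y j j′} → j ℕ.< f → j′ ℕ.< f →
                         x₂-coord i y (+ j) ≡ x₂-coord i y (+ j′) mod k → j ≡ j′
    x₂-coord-injective {y} {j} {j′} j<f j′<f eq =
      ℕ.*-cancelʳ-≡ j j′ r (<-mod-injective (jr<k j<f) (jr<k j′<f) jr≡j′r)
      where
      jr<k : ∀ {t} → t ℕ.< f → t ℕ.* r ℕ.< k
      jr<k {t} t<f = subst (t ℕ.* r ℕ.<_) (sym k≡f*r) (ℕ.*-monoˡ-< r t<f)
      jr≡j′r : + (j ℕ.* r) ≡ + (j′ ℕ.* r) mod k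
      jr≡j′r = subst₂ (_≡_mod k) (sym (ℤ.pos-* j r)) (sym (ℤ.pos-* j′ r))
                      (+-cancelˡ-mod (- (q₃ * y)) eq)

    x₁-coord-cong : ∀ {x x′} → x ≡ x′ mod r → x₁-coord i x ≡ x₁-coord i x′ mod k
    x₁-coord-cong {x} {x′} x≡x′ =
      subst₂ (_≡_mod k) (tangle x) (tangle x′) (scale-mod-k (-‿cong-mod (*-congˡ-mod ā x≡x′)))
      where
      tangle : ∀ x → + f * - (ā * x) ≡ x₁-coord i x
      tangle x = solve 3 (λ f ā x → f :* :- (ā :* x) := :- (f :* ā :* x)) refl (+ f) ā x

    x₁-coord-[-αu] : ∀ u → x₁-coord i (- (α * u)) ≡ + f * u mod k
    x₁-coord-[-αu] u = begin
      - (+ f * ā * - (α * u))  ≡⟨ solve 4 (λ f ā α u → :- (f :* ā :* :- (α :* u)) := f :* (α :* ā :* u))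
                                          refl (+ f) ā α u ⟩
      + f * (α * ā * u)        ≈⟨ scale-mod-k (*-congʳ-mod u αā≡1) ⟩
      + f * (+ 1 * u)          ≡⟨ cong (+ f *_) (ℤ.*-identityˡ u) ⟩
      + f * u                  ∎
      where open ≡mod-Reasoning k

    lift-mod-r : ∀ {a b} → a ≡ b mod r → Σ ℕ λ j → j ℕ.< f × a ≡ b + + j * + r mod k
    lift-mod-r {a} {b} (congruent t eq) = modN t f , modN-< t f , congruent (t /ℕ f) (begin
      a
        ≡⟨ eq ⟩
      b + t * + r
        ≡⟨ cong (λ t → b + t * + r) (a≡a%ℕn+[a/ℕn]*n t f) ⟩
      b + (+ modN t f + t /ℕ f * + f) * + r
        ≡⟨ solve 5 (λ b j q f r → b :+ (j :+ q :* f) :* r := b :+ j :* r :+ q :* (f :* r))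
                   refl b (+ modN t f) (t /ℕ f) (+ f) (+ r) ⟩
      b + + modN t f * + r + t /ℕ f * (+ f * + r)
        ≡⟨ cong (λ n → b + + modN t f * + r + t /ℕ f * n) f·r≡k ⟩
      b + + modN t f * + r + t /ℕ f * + k
        ∎)
      where open ≡-Reasoning

    module _ {u x₂ : ℕ} (sol : + (u ℕ.* f) * + x₂ * α ≡ p₃ mod k) where

      solution-f∣p₃ : f ∣ ∣ p₃ ∣
      solution-f∣p₃ = ≡0-mod⇒∣ p₃ (begin
        p₃                          ≈⟨ mod-k⇒mod-f (≡mod-sym sol) ⟩
        + (u ℕ.* f) * + x₂ * α      ≈⟨ *-congʳ-mod α (*-congʳ-mod (+ x₂) uf≡0) ⟩
        + 0 * + x₂ * α              ≡⟨⟩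
        + 0                         ∎)
        where
        open ≡mod-Reasoning f
        uf≡0 : + (u ℕ.* f) ≡ + 0 mod f
        uf≡0 = ≡mod-trans (≡mod-reflexive (ℤ.pos-* u f)) (*n≡0-mod (+ u))

      solution-αux₂≡q₃ : α * + u * + x₂ ≡ q₃ mod r
      solution-αux₂≡q₃ = cancel-mod-k (begin
        + f * (α * + u * + x₂)    ≡⟨ solve 4 (λ f α u x₂ → f :* (α :* u :* x₂) := u :* f :* x₂ :* α)
                                             refl (+ f) α (+ u) (+ x₂) ⟩
        + u * + f * + x₂ * α      ≡⟨ cong (λ n → n * + x₂ * α) (ℤ.pos-* u f) ⟨
        + (u ℕ.* f) * + x₂ * α    ≈⟨ sol ⟩
        p₃                        ≡⟨ q₃*f≡p₃ solution-f∣p₃ ⟨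
        q₃ * + f                  ≡⟨ ℤ.*-comm q₃ (+ f) ⟩
        + f * q₃                  ∎)
        where open ≡mod-Reasoning k

      solution-x₂ : ∀ {v} → + u * v ≡ + 1 mod r → + x₂ ≡ - (q₃ * - (ā * v)) mod r
      solution-x₂ {v} uv≡1 = ≡mod-sym (begin
        - (q₃ * - (ā * v))          ≡⟨ solve 3 (λ q ā v → :- (q :* :- (ā :* v)) := q :* (ā :* v))
                                               refl q₃ ā v ⟩
        q₃ * (ā * v)                ≈⟨ *-congʳ-mod (ā * v) (≡mod-sym solution-αux₂≡q₃) ⟩
        α * + u * + x₂ * (ā * v)    ≡⟨ solve 5 (λ α u x₂ ā v → α :* u :* x₂ :* (ā :* v)
                                                             := α :* ā :* (u :* v) :* x₂)
                                               refl α (+ u) (+ x₂) ā v ⟩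
        α * ā * (+ u * v) * + x₂    ≈⟨ *-congʳ-mod (+ x₂) (*-cong-mod αā≡1 uv≡1) ⟩
        + 1 * + 1 * + x₂            ≡⟨ ℤ.*-identityˡ (+ x₂) ⟩
        + x₂                        ∎)
        where open ≡mod-Reasoning r

    preimage : ∀ {x₁ x₂} → x₁ ℕ.< k → x₂ ℕ.< k → f ∣ x₁ → Bézout.Identity f x₁ k →
               Solution x₁ x₂ → Preimage x₁ x₂
    preimage {x₂ = x₂} x₁<k x₂<k (divides u refl) bez sol = record
      { i = i ; x = x ; y = y ; j = j
      ; i<k = ∣⇒≤ f∣k ; x<r = modN-< (- (α * + u)) r ; y<r = modN-< (- (ā * v)) r ; j<f = j<f
      ; parametrises = parametrisation (solution-f∣p₃ {u} {x₂} sol′ , f∣k) (≡mod⇒modN≡ xy≡1)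
                                       (≡mod⇒≡modN x₁<k x₁≡) (≡mod⇒≡modN x₂<k x₂≡)
      }
      where
      sol′ : + (u ℕ.* f) * + x₂ * α ≡ p₃ mod k
      sol′ = Solution⇒≡mod {u ℕ.* f} {x₂} sol
      inverse : Σ ℤ λ v → + u * v ≡ + 1 mod r
      inverse = bézout-inverse {f} {r} {u} (subst (Bézout.Identity f (u ℕ.* f)) k≡f*r bez)
      v : ℤ
      v = proj₁ inverse
      uv≡1 : + u * v ≡ + 1 mod r
      uv≡1 = proj₂ inverse
      x y : ℕ
      x = modN (- (α * + u)) r
      y = modN (- (ā * v)) r
      xy≡1 : + (x ℕ.* y) ≡ + 1 mod r
      xy≡1 = begin
        + (x ℕ.* y)                ≡⟨ ℤ.pos-* x y ⟩
        + x * + y                  ≈⟨ *-cong-mod (modN≡mod (- (α * + u)) r) (modN≡mod (- (ā * v)) r) ⟩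
        - (α * + u) * - (ā * v)    ≡⟨ solve 4 (λ α u ā v → :- (α :* u) :* :- (ā :* v) := α :* ā :* (u :* v))
                                              refl α (+ u) ā v ⟩
        α * ā * (+ u * v)          ≈⟨ *-cong-mod αā≡1 uv≡1 ⟩
        + 1                        ∎
        where open ≡mod-Reasoning r
      x₁≡ : + (u ℕ.* f) ≡ x₁-coord i (+ x) mod k
      x₁≡ = ≡mod-sym (begin
        x₁-coord i (+ x)          ≈⟨ x₁-coord-cong (modN≡mod (- (α * + u)) r) ⟩
        x₁-coord i (- (α * + u))  ≈⟨ x₁-coord-[-αu] (+ u) ⟩
        + f * + u                 ≡⟨ ℤ.*-comm (+ f) (+ u) ⟩
        + u * + f                 ≡⟨ ℤ.pos-* u f ⟨
        + (u ℕ.* f)               ∎)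
        where open ≡mod-Reasoning k
      x₂≡-q₃y : + x₂ ≡ - (q₃ * + y) mod r
      x₂≡-q₃y = ≡mod-trans (solution-x₂ {u} {x₂} sol′ uv≡1)
                           (-‿cong-mod (*-congˡ-mod q₃ (≡mod-sym (modN≡mod (- (ā * v)) r))))
      lift : Σ ℕ λ j → j ℕ.< f × + x₂ ≡ - (q₃ * + y) + + j * + r mod k
      lift = lift-mod-r x₂≡-q₃y
      j : ℕ
      j = proj₁ lift
      j<f : j ℕ.< f
      j<f = proj₁ (proj₂ lift)
      x₂≡ : + x₂ ≡ x₂-coord i (+ y) (+ j) mod k
      x₂≡ = proj₂ (proj₂ lift)

  divisor-∣ : ∀ {i i′} (f∣k : suc i ∣ k) (f′∣k : suc i′ ∣ k) {x x′ y′ x₁} →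
              x′ * y′ ≡ + 1 mod (k / suc i′) →
              x₁ ≡ x₁-coord i x mod k → x₁ ≡ x₁-coord i′ x′ mod k → suc i ∣ suc i′
  divisor-∣ {i} {i′} f∣k f′∣k {x} {x′} {y′} {x₁} x′y′≡1 x₁≡ x₁≡′ =
    ≡0-mod⇒∣ (+ suc i′) (begin
      + suc i′              ≈⟨ D.mod-k⇒mod-f (D′.f≡x₁*[-αy] x′y′≡1 x₁≡′) ⟩
      x₁ * - (α * y′)       ≈⟨ *-congʳ-mod (- (α * y′)) (D.x₁-coord≡0-mod-f x₁≡) ⟩
      + 0 * - (α * y′)      ≡⟨ ℤ.*-zeroˡ (- (α * y′)) ⟩
      + 0                   ∎)
    where
    module D = Divisor f∣k
    module D′ = Divisor f′∣k
    open ≡mod-Reasoning (suc i)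

  parametrises⇒Solution : ∀ {i x y j x₁ x₂} → Parametrises i x y j x₁ x₂ → Solution x₁ x₂
  parametrises⇒Solution {x = x} {y} {j} {x₁} {x₂} (parametrisation (f∣p₃ , f∣k) xy≡1 x₁≡ x₂≡) =
    ≡mod⇒Solution {x₁} {x₂}
      (coords-solution {j = + j} f∣p₃ (xy≡1-mod-r {x} {y} xy≡1) (≡modN⇒≡mod x₁≡) (≡modN⇒≡mod x₂≡))
    where open Divisor f∣k

  parametrises-divisor-unique : ∀ {i x y j i′ x′ y′ j′ x₁ x₂} →
    Parametrises i x y j x₁ x₂ → Parametrises i′ x′ y′ j′ x₁ x₂ → i ≡ i′
  parametrises-divisor-unique {x = x} {y} {x′ = x′} {y′}
    (parametrisation (_ , f∣k) xy≡1 x₁≡ _) (parametrisation (_ , f′∣k) x′y′≡1 x₁≡′ _) =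
    ℕ.suc-injective (∣-antisym
      (divisor-∣ f∣k f′∣k (Divisor.xy≡1-mod-r f′∣k {x′} {y′} x′y′≡1)
                 (≡modN⇒≡mod x₁≡) (≡modN⇒≡mod x₁≡′))
      (divisor-∣ f′∣k f∣k (Divisor.xy≡1-mod-r f∣k {x} {y} xy≡1)
                 (≡modN⇒≡mod x₁≡′) (≡modN⇒≡mod x₁≡)))

  parametrises-unique : ∀ {i x y j x′ y′ j′ x₁ x₂} →
    Parametrises i x y j x₁ x₂ → Parametrises i x′ y′ j′ x₁ x₂ →
    x ℕ.< k / suc i → x′ ℕ.< k / suc i → y ℕ.< k / suc i → y′ ℕ.< k / suc i →
    j ℕ.< suc i → j′ ℕ.< suc i → x ≡ x′ × y ≡ y′ × j ≡ j′
  parametrises-unique {i} {x} {y} {j} {x′} {y′} {j′} {x₁} {x₂}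
                      (parametrisation (_ , f∣k) xy≡1 x₁≡ x₂≡) (parametrisation _ x′y′≡1 x₁≡′ x₂≡′)
                      x<r x′<r y<r y′<r j<f j′<f =
    x≡x′ , y≡y′ , j≡j′
    where
    open Divisor f∣k
    x≡x′ : x ≡ x′
    x≡x′ = <-mod-injective x<r x′<r
             (x₁-coord-injective (≡mod-trans (≡mod-sym (≡modN⇒≡mod x₁≡)) (≡modN⇒≡mod x₁≡′)))
    y≡y′ : y ≡ y′
    y≡y′ = <-mod-injective y<r y′<r (*-inverse-unique {x = + x} (xy≡1-mod-r {x} {y} xy≡1)
             (subst (λ t → + t * + y′ ≡ + 1 mod r) (sym x≡x′) (xy≡1-mod-r {x′} {y′} x′y′≡1)))
    j≡j′ : j ≡ j′
    j≡j′ = x₂-coord-injective j<f j′<f (≡mod-trans (≡mod-sym (≡modN⇒≡mod x₂≡))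
             (subst (λ t → + x₂ ≡ x₂-coord i (+ t) (+ j′) mod k) (sym y≡y′) (≡modN⇒≡mod x₂≡′)))

  -- f = gcd(x₁, k), and Bézout inverts x₁/f modulo k/f.
  Solution⇒Preimage : ∀ {x₁ x₂} → x₁ ℕ.< k → x₂ ℕ.< k → Solution x₁ x₂ → Preimage x₁ x₂
  Solution⇒Preimage {x₁} x₁<k x₂<k sol
    with gcd x₁ k | gcd[m,n]∣m x₁ k | gcd[m,n]∣n x₁ k | Bézout.identity (gcd-GCD x₁ k)
  ... | zero  | _    | 0∣k | _   = ⊥-elim (ℕ.≢-nonZero⁻¹ k (0∣⇒≡0 0∣k))
  ... | suc i | f∣x₁ | f∣k | bez = Divisor.preimage f∣k x₁<k x₂<k f∣x₁ bez sol

module CharacterSums {c ℓ : Level} (R : CommutativeRing c ℓ) where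

  open Sums R
  open CommutativeRing R hiding (Carrier; _≈_)
  open import Algebra.Properties.Semiring.Exp semiring using (_^_; ^-homo-*; ^-assocʳ)
  open import Algebra.Properties.Semiring.Mult semiring using (_×_; ×-assoc-*; ×-congʳ)
  import Algebra.Properties.AbelianGroup +-abelianGroup as +-Group
  import Algebra.Properties.Ring ring as Ring
  import Algebra.Solver.Ring.NaturalCoefficients.Default commutativeSemiring as Solver
  open import Relation.Binary.Reasoning.Setoid setoid

  pow≡^ : ∀ x n → pow x n ≡ x ^ n
  pow≡^ x zero    = ≡.refl
  pow≡^ x (suc n) = ≡.cong (x *_) (pow≡^ x n)

  pow-+ : ∀ x m n → pow x (m ℕ.+ n) ≈ pow x m * pow x n
  pow-+ x m n = begin
    pow x (m ℕ.+ n)     ≡⟨ pow≡^ x (m ℕ.+ n) ⟩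
    x ^ (m ℕ.+ n)       ≈⟨ ^-homo-* x m n ⟩
    x ^ m * x ^ n       ≡⟨ ≡.cong₂ _*_ (pow≡^ x m) (pow≡^ x n) ⟨
    pow x m * pow x n   ∎

  pow-* : ∀ x m n → pow x (m ℕ.* n) ≈ pow (pow x m) n
  pow-* x m n = begin
    pow x (m ℕ.* n)     ≡⟨ pow≡^ x (m ℕ.* n) ⟩
    x ^ (m ℕ.* n)       ≈⟨ ^-assocʳ x m n ⟨
    (x ^ m) ^ n         ≡⟨ ≡.trans (pow≡^ (pow x m) n) (≡.cong (_^ n) (pow≡^ x m)) ⟨
    pow (pow x m) n     ∎

  scal≡× : ∀ n x → scal n x ≡ n × x
  scal≡× zero    x = ≡.refl
  scal≡× (suc n) x = ≡.cong (_+_ x) (scal≡× n x)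

  scal≈scal1* : ∀ n x → scal n x ≈ scal n 1# * x
  scal≈scal1* n x = begin
    scal n x            ≡⟨ scal≡× n x ⟩
    n × x               ≈⟨ ×-congʳ n (*-identityˡ x) ⟨
    n × (1# * x)        ≈⟨ ×-assoc-* n 1# x ⟨
    (n × 1#) * x        ≡⟨ ≡.cong (_* x) (scal≡× n 1#) ⟨
    scal n 1# * x       ∎

  sumTo-cong< : ∀ n {f g : ℕ → Carrier} → (∀ i → i ℕ.< n → f i ≈ g i) → sumTo n f ≈ sumTo n g
  sumTo-cong< zero    f≈g = refl
  sumTo-cong< (suc n) f≈g = +-cong (sumTo-cong< n (λ i i<n → f≈g i (ℕ.m<n⇒m<1+n i<n))) (f≈g n ℕ.≤-refl)

  sumTo-cong : ∀ n {f g : ℕ → Carrier} → (∀ i → f i ≈ g i) → sumTo n f ≈ sumTo n g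
  sumTo-cong n f≈g = sumTo-cong< n (λ i _ → f≈g i)

  sumTo-zero : ∀ n (f : ℕ → Carrier) → (∀ i → i ℕ.< n → f i ≈ 0#) → sumTo n f ≈ 0#
  sumTo-zero zero    f f≈0 = refl
  sumTo-zero (suc n) f f≈0 =
    trans (+-cong (sumTo-zero n f (λ i i<n → f≈0 i (ℕ.m<n⇒m<1+n i<n))) (f≈0 n ℕ.≤-refl)) (+-identityˡ 0#)

  sumTo-single : ∀ n (f : ℕ → Carrier) {i₀} → i₀ ℕ.< n →
                 (∀ i → i ℕ.< n → i ≢ i₀ → f i ≈ 0#) → sumTo n f ≈ f i₀
  sumTo-single (suc n) f {i₀} i₀<1+n f≈0 with ℕ.<-cmp i₀ n
  ... | tri≈ _ ≡.refl _ =
    trans (+-congʳ (sumTo-zero n f (λ i i<n → f≈0 i (ℕ.m<n⇒m<1+n i<n) (ℕ.<⇒≢ i<n)))) (+-identityˡ _)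
  ... | tri< i₀<n _ _ =
    trans (+-cong (sumTo-single n f i₀<n (λ i i<n → f≈0 i (ℕ.m<n⇒m<1+n i<n)))
                  (f≈0 n ℕ.≤-refl (ℕ.>⇒≢ i₀<n)))
          (+-identityʳ _)
  ... | tri> _ _ n<i₀ = ⊥-elim (ℕ.<⇒≱ i₀<1+n n<i₀)

  sumTo-distrib-+ : ∀ n (f g : ℕ → Carrier) → sumTo n (λ i → f i + g i) ≈ sumTo n f + sumTo n g
  sumTo-distrib-+ zero    f g = sym (+-identityˡ 0#)
  sumTo-distrib-+ (suc n) f g = begin
    sumTo n (λ i → f i + g i) + (f n + g n)  ≈⟨ +-congʳ (sumTo-distrib-+ n f g) ⟩
    (sumTo n f + sumTo n g) + (f n + g n)    ≈⟨ Solver.solve 4 (λ a b c d → (a :+ b) :+ (c :+ d)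
                                                                      := (a :+ c) :+ (b :+ d))
                                                                refl (sumTo n f) (sumTo n g) (f n) (g n) ⟩
    (sumTo n f + f n) + (sumTo n g + g n)    ∎
    where open Solver using (_:+_; _:=_)

  *-distribˡ-sumTo : ∀ n x (f : ℕ → Carrier) → x * sumTo n f ≈ sumTo n (λ i → x * f i)
  *-distribˡ-sumTo zero    x f = zeroʳ x
  *-distribˡ-sumTo (suc n) x f = trans (distribˡ x (sumTo n f) (f n)) (+-congʳ (*-distribˡ-sumTo n x f))

  *-distribʳ-sumTo : ∀ n x (f : ℕ → Carrier) → sumTo n f * x ≈ sumTo n (λ i → f i * x)
  *-distribʳ-sumTo n x f =
    trans (*-comm _ x) (trans (*-distribˡ-sumTo n x f) (sumTo-cong n (λ i → *-comm x (f i))))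

  sumTo-comm : ∀ m n (f : ℕ → ℕ → Carrier) →
               sumTo m (λ i → sumTo n (λ j → f i j)) ≈ sumTo n (λ j → sumTo m (λ i → f i j))
  sumTo-comm zero    n f = sym (sumTo-zero n _ (λ _ _ → refl))
  sumTo-comm (suc m) n f = begin
    sumTo m (λ i → sumTo n (f i)) + sumTo n (f m)          ≈⟨ +-congʳ (sumTo-comm m n f) ⟩
    sumTo n (λ j → sumTo m (λ i → f i j)) + sumTo n (f m)  ≈⟨ sumTo-distrib-+ n _ _ ⟨
    sumTo n (λ j → sumTo m (λ i → f i j) + f m j)          ∎

  sumTo-comm₂ : ∀ l m n (f : ℕ → ℕ → ℕ → Carrier) →
                sumTo l (λ i → sumTo m (λ a → sumTo n (λ b → f i a b))) ≈
                sumTo m (λ a → sumTo n (λ b → sumTo l (λ i → f i a b)))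
  sumTo-comm₂ l m n f = trans (sumTo-comm l m _) (sumTo-cong m (λ a → sumTo-comm l n _))

  sumTo-const : ∀ n x → sumTo n (λ _ → x) ≈ scal n x
  sumTo-const zero    x = refl
  sumTo-const (suc n) x = trans (+-congʳ (sumTo-const n x)) (+-comm _ x)

  [_] : ∀ {p} {A : Set p} → Dec A → Carrier
  [ yes _ ] = 1#
  [ no  _ ] = 0#

  if-then-0≈[]* : ∀ {p} {A : Set p} (d : Dec A) x → (if ⌊ d ⌋ then x else 0#) ≈ [ d ] * x
  if-then-0≈[]* (yes _) x = sym (*-identityˡ x)
  if-then-0≈[]* (no  _) x = sym (zeroˡ x)

  []-×-dec : ∀ {p q} {A : Set p} {B : Set q} (a : Dec A) (b : Dec B) → [ a ×-dec b ] ≈ [ a ] * [ b ]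
  []-×-dec (yes _) (yes _) = sym (*-identityˡ _)
  []-×-dec (yes _) (no  _) = sym (*-identityˡ _)
  []-×-dec (no  _) _       = sym (zeroˡ _)

  []-yes : ∀ {p} {A : Set p} (d : Dec A) → A → [ d ] ≈ 1#
  []-yes (yes _) _ = refl
  []-yes (no ¬a) a = ⊥-elim (¬a a)

  []-no : ∀ {p} {A : Set p} (d : Dec A) → ¬ A → [ d ] ≈ 0#
  []-no (yes a) ¬a = ⊥-elim (¬a a)
  []-no (no  _) _  = refl

  []-map′ : ∀ {p q} {A : Set p} {B : Set q} {f : A → B} {g : B → A} (d : Dec A) → [ map′ f g d ] ≈ [ d ]
  []-map′ (yes _) = refl
  []-map′ (no  _) = refl

  sumTo-[≟]* : ∀ n {c} (g : ℕ → Carrier) → c ℕ.< n → sumTo n (λ a → [ a ℕ.≟ c ] * g a) ≈ g c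
  sumTo-[≟]* n {c} g c<n = begin
    sumTo n (λ a → [ a ℕ.≟ c ] * g a)
      ≈⟨ sumTo-single n _ c<n (λ a _ a≢c → trans (*-congʳ ([]-no (a ℕ.≟ c) a≢c)) (zeroˡ _)) ⟩
    [ c ℕ.≟ c ] * g c
      ≈⟨ *-congʳ ([]-yes (c ℕ.≟ c) ≡.refl) ⟩
    1# * g c
      ≈⟨ *-identityˡ (g c) ⟩
    g c
      ∎

  pow-root-of-unity : ∀ {η n} → pow η n ≈ 1# → ∀ q → pow η (q ℕ.* n) ≈ 1#
  pow-root-of-unity η^n≈1 zero = refl
  pow-root-of-unity {η} {n} η^n≈1 (suc q) = begin
    pow η (n ℕ.+ q ℕ.* n)      ≈⟨ pow-+ η n (q ℕ.* n) ⟩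
    pow η n * pow η (q ℕ.* n)  ≈⟨ *-cong η^n≈1 (pow-root-of-unity η^n≈1 q) ⟩
    1# * 1#                    ≈⟨ *-identityˡ 1# ⟩
    1#                         ∎

  pow≈ex : ∀ η n .{{_ : NonZero n}} → pow η n ≈ 1# → ∀ m → pow η m ≈ ex η n (+ m)
  pow≈ex η n@(suc _) η^n≈1 m = begin
    pow η m                                      ≡⟨ ≡.cong (pow η) (ℕ.m≡m%n+[m/n]*n m n) ⟩
    pow η (m ℕ.% n ℕ.+ (m / n) ℕ.* n)            ≈⟨ pow-+ η (m ℕ.% n) ((m / n) ℕ.* n) ⟩
    pow η (m ℕ.% n) * pow η ((m / n) ℕ.* n)      ≈⟨ *-congˡ (pow-root-of-unity η^n≈1 (m / n)) ⟩
    pow η (m ℕ.% n) * 1#                         ≈⟨ *-identityʳ _ ⟩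
    pow η (m ℕ.% n)                              ∎

  ex-cong : ∀ η n .{{_ : NonZero n}} {a b} → a ≡ b mod n → ex η n a ≈ ex η n b
  ex-cong η n a≡b = reflexive (≡.cong (pow η) (≡mod⇒modN≡ a≡b))

  ex-pow : ∀ {ζ k} .{{_ : NonZero k}} → pow ζ k ≈ 1# →
           ∀ r m .{{_ : NonZero m}} → k ≡ r ℕ.* m → ∀ a → ex (pow ζ r) m a ≈ ex ζ k (+ r ℤ.* a)
  ex-pow {ζ} {k} ζ^k≈1 r m k≡rm a = begin
    pow (pow ζ r) (modN a m)     ≈⟨ pow-* ζ r (modN a m) ⟨
    pow ζ (r ℕ.* modN a m)       ≈⟨ pow≈ex ζ k ζ^k≈1 (r ℕ.* modN a m) ⟩
    ex ζ k (+ (r ℕ.* modN a m))  ≈⟨ ex-cong ζ k ra≡ra′ ⟩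
    ex ζ k (+ r ℤ.* a)           ∎
    where
    ra≡ra′ : + (r ℕ.* modN a m) ≡ + r ℤ.* a mod k
    ra≡ra′ = ≡mod-trans (≡mod-reflexive (ℤ.pos-* r (modN a m)))
                        (≡.subst (_ ≡ _ mod_) (≡.sym k≡rm) (scale-mod r (modN≡mod a m)))

  pow-primitive : ∀ {ζ k} r m .{{_ : NonZero r}} → k ≡ r ℕ.* m →
                  PrimitiveRoot ζ k → PrimitiveRoot (pow ζ r) m
  pow-primitive {ζ} r m k≡rm (ζ^k≈1 , ζ^j≉1) = η^m≈1 , η^j≉1
    where
    η^m≈1 : pow (pow ζ r) m ≈ 1#
    η^m≈1 = trans (sym (pow-* ζ r m)) (trans (reflexive (≡.cong (pow ζ) (≡.sym k≡rm))) ζ^k≈1)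
    η^j≉1 : ∀ j → 0 ℕ.< j → j ℕ.< m → ¬ pow (pow ζ r) j ≈ 1#
    η^j≉1 j 0<j j<m η^j≈1 =
      ζ^j≉1 (r ℕ.* j) (ℕ.<-≤-trans 0<j (ℕ.m≤n*m j r))
            (≡.subst (r ℕ.* j ℕ.<_) (≡.sym k≡rm) (ℕ.*-monoʳ-< r j<m))
            (trans (pow-* ζ r j) η^j≈1)

  geometric-sum : ∀ w m → 1# + w * sumTo m (pow w) ≈ sumTo m (pow w) + pow w m
  geometric-sum w zero = trans (+-congˡ (zeroʳ w)) (trans (+-identityʳ 1#) (sym (+-identityˡ 1#)))
  geometric-sum w (suc m) = begin
    1# + w * (sumTo m (pow w) + pow w m)
      ≈⟨ Solver.solve 3 (λ w s p → con 1 :+ w :* (s :+ p) := (con 1 :+ w :* s) :+ w :* p)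
                        refl w (sumTo m (pow w)) (pow w m) ⟩
    (1# + w * sumTo m (pow w)) + pow w (suc m)
      ≈⟨ +-congʳ (geometric-sum w m) ⟩
    (sumTo m (pow w) + pow w m) + pow w (suc m)
      ∎
    where open Solver using (_:+_; _:*_; _:=_; con)

  sumTo-pow-vanishes : NoZeroDivisors → ∀ {w n} → ¬ w ≈ 1# → pow w n ≈ 1# → sumTo n (pow w) ≈ 0#
  sumTo-pow-vanishes no-zero-divisors {w} {n} w≉1 w^n≈1
    with no-zero-divisors (w - 1#) (sumTo n (pow w)) w-1·G≈0
    where
    G : Carrier
    G = sumTo n (pow w)
    w·G≈G : w * G ≈ G
    w·G≈G = +-Group.∙-cancelˡ 1# (w * G) G (begin
      1# + w * G   ≈⟨ geometric-sum w n ⟩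
      G + pow w n  ≈⟨ +-congˡ w^n≈1 ⟩
      G + 1#       ≈⟨ +-comm G 1# ⟩
      1# + G       ∎)
    w-1·G≈0 : (w - 1#) * G ≈ 0#
    w-1·G≈0 = begin
      (w - 1#) * G        ≈⟨ distribʳ G w (- 1#) ⟩
      w * G + - 1# * G    ≈⟨ +-cong w·G≈G (Ring.-1*x≈-x G) ⟩
      G - G               ≈⟨ -‿inverseʳ G ⟩
      0#                  ∎
  ... | inj₁ w-1≈0 = ⊥-elim (w≉1 (+-Group.x∙y⁻¹≈ε⇒x≈y w 1# w-1≈0))
  ... | inj₂ G≈0   = G≈0

  module Character (no-zero-divisors : NoZeroDivisors)
                   (n : ℕ) .{{_ : NonZero n}} (η : Carrier) (η-primitive : PrimitiveRoot η n) where

    η^n≈1 : pow η n ≈ 1#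
    η^n≈1 = proj₁ η-primitive

    e : ℤ → Carrier
    e = ex η n

    e-cong : ∀ {a b} → a ≡ b mod n → e a ≈ e b
    e-cong = ex-cong η n

    e-+ : ∀ a b → e (a ℤ.+ b) ≈ e a * e b
    e-+ a b = begin
      e (a ℤ.+ b)
        ≈⟨ e-cong (+-cong-mod (≡mod-sym (modN≡mod a n)) (≡mod-sym (modN≡mod b n))) ⟩
      e (+ modN a n ℤ.+ + modN b n)
        ≡⟨ ≡.cong e (ℤ.pos-+ (modN a n) (modN b n)) ⟨
      e (+ (modN a n ℕ.+ modN b n))
        ≈⟨ pow≈ex η n η^n≈1 (modN a n ℕ.+ modN b n) ⟨
      pow η (modN a n ℕ.+ modN b n)
        ≈⟨ pow-+ η (modN a n) (modN b n) ⟩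
      e a * e b
        ∎

    e-* : ∀ j c → e (+ j ℤ.* c) ≈ pow (e c) j
    e-* zero    c = trans (e-cong (≡mod-reflexive (ℤ.*-zeroˡ c))) (sym (pow≈ex η n η^n≈1 0))
    e-* (suc j) c = begin
      e (+ suc j ℤ.* c)       ≡⟨ ≡.cong e (ℤ.suc-* (+ j) c) ⟩
      e (c ℤ.+ + j ℤ.* c)     ≈⟨ e-+ c (+ j ℤ.* c) ⟩
      e c * e (+ j ℤ.* c)     ≈⟨ *-congˡ (e-* j c) ⟩
      pow (e c) (suc j)       ∎

    orthogonality : ∀ c → sumTo n (λ j → e (+ j ℤ.* c)) ≈ [ n ∣? ∣ c ∣ ] * scal n 1#
    orthogonality c with n ∣? ∣ c ∣
    ... | yes n∣c = begin
      sumTo n (λ j → e (+ j ℤ.* c))  ≈⟨ sumTo-cong n e[jc]≈1 ⟩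
      sumTo n (λ _ → 1#)             ≈⟨ sumTo-const n 1# ⟩
      scal n 1#                      ≈⟨ *-identityˡ _ ⟨
      1# * scal n 1#                 ∎
      where
      e[jc]≈1 : ∀ j → e (+ j ℤ.* c) ≈ 1#
      e[jc]≈1 j = trans (e-cong (≡mod-trans (*-congˡ-mod (+ j) (∣⇒≡0-mod c n∣c))
                                            (≡mod-reflexive (ℤ.*-zeroʳ (+ j)))))
                        (sym (pow≈ex η n η^n≈1 0))
    ... | no n∤c = begin
      sumTo n (λ j → e (+ j ℤ.* c))  ≈⟨ sumTo-cong n (λ j → e-* j c) ⟩
      sumTo n (pow (e c))            ≈⟨ sumTo-pow-vanishes no-zero-divisors {n = n} e[c]≉1 e[c]^n≈1 ⟩
      0#                             ≈⟨ zeroˡ _ ⟨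
      0# * scal n 1#                 ∎
      where
      r : ℕ
      r = modN c n
      e[c]^n≈1 : pow (e c) n ≈ 1#
      e[c]^n≈1 = trans (sym (pow-* η r n)) (pow-root-of-unity η^n≈1 r)
      e[c]≉1 : ¬ e c ≈ 1#
      e[c]≉1 = proj₂ η-primitive r (ℕ.n≢0⇒n>0 r≢0) (modN-< c n)
        where
        r≢0 : r ≢ 0
        r≢0 r≡0 = n∤c (≡0-mod⇒∣ c (modN≡⇒≡mod (≡.trans r≡0 (≡.sym (modN-of-< 0<n)))))
          where
          0<n : 0 ℕ.< n
          0<n = ℕ.>-nonZero⁻¹ n

  module Evaluation (no-zero-divisors : NoZeroDivisors) (k : ℕ) .{{_ : NonZero k}}
                    (ζ : Carrier) (ζ-primitive : PrimitiveRoot ζ k) (α p₁ p₂ p₃ : ℤ) (ᾱ : ℕ → ℤ)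
                    (ᾱ-inverse : ∀ i → suc i ∣ k →
                       modN (α ℤ.* ᾱ (suc i)) (k / suc i) ≡ modN (+ 1) (k / suc i)) where

    open Character no-zero-divisors k ζ ζ-primitive
    open Parametrisation k α p₃ ᾱ ᾱ-inverse

    phase : ℕ → ℕ → Carrier
    phase x₁ x₂ = e (ℤ.- (+ x₁ ℤ.* p₁) ℤ.- + x₂ ℤ.* p₂)

    solution? : ∀ x₁ x₂ → Dec (Solution x₁ x₂)
    solution? x₁ x₂ = k ∣? ∣ + x₁ ℤ.* + x₂ ℤ.* α ℤ.- p₃ ∣

    solutionSum : Carrier
    solutionSum = sumTo k λ x₁ → sumTo k λ x₂ → [ solution? x₁ x₂ ] * phase x₁ x₂

    cubicPhase : ℕ → ℕ → ℕ → ℤ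
    cubicPhase x₁ x₂ x₃ = + x₁ ℤ.* + x₂ ℤ.* + x₃ ℤ.* α ℤ.- + x₁ ℤ.* p₁ ℤ.- + x₂ ℤ.* p₂ ℤ.- + x₃ ℤ.* p₃

    sum-over-x₃ : ∀ x₁ x₂ →
      sumTo k (λ x₃ → e (cubicPhase x₁ x₂ x₃)) ≈ scal k 1# * ([ solution? x₁ x₂ ] * phase x₁ x₂)
    sum-over-x₃ x₁ x₂ = begin
      sumTo k (λ x₃ → e (cubicPhase x₁ x₂ x₃))
        ≈⟨ sumTo-cong k (λ x₃ → trans (reflexive (≡.cong e (regroup (+ x₁) (+ x₂) (+ x₃) α p₁ p₂ p₃)))
                                      (e-+ _ _)) ⟩
      sumTo k (λ x₃ → phase x₁ x₂ * e (+ x₃ ℤ.* m))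
        ≈⟨ *-distribˡ-sumTo k (phase x₁ x₂) _ ⟨
      phase x₁ x₂ * sumTo k (λ x₃ → e (+ x₃ ℤ.* m))
        ≈⟨ *-congˡ (orthogonality m) ⟩
      phase x₁ x₂ * ([ solution? x₁ x₂ ] * scal k 1#)
        ≈⟨ Solver.solve 3 (λ a b c → a :* (b :* c) := c :* (b :* a))
                          refl (phase x₁ x₂) [ solution? x₁ x₂ ] (scal k 1#) ⟩
      scal k 1# * ([ solution? x₁ x₂ ] * phase x₁ x₂)
        ∎
      where
      open Solver using (_:*_; _:=_)
      m : ℤ
      m = + x₁ ℤ.* + x₂ ℤ.* α ℤ.- p₃
      regroup : ∀ x₁ x₂ x₃ α p₁ p₂ p₃ →
        x₁ ℤ.* x₂ ℤ.* x₃ ℤ.* α ℤ.- x₁ ℤ.* p₁ ℤ.- x₂ ℤ.* p₂ ℤ.- x₃ ℤ.* p₃ ≡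
        (ℤ.- (x₁ ℤ.* p₁) ℤ.- x₂ ℤ.* p₂) ℤ.+ x₃ ℤ.* (x₁ ℤ.* x₂ ℤ.* α ℤ.- p₃)
      regroup = ℤ-Tactic.solve-∀

    Asum≈k·solutionSum : Asum ζ p₁ p₂ p₃ α k ≈ scal k 1# * solutionSum
    Asum≈k·solutionSum = begin
      Asum ζ p₁ p₂ p₃ α k
        ≈⟨ sumTo-cong k (λ x₁ → sumTo-cong k (sum-over-x₃ x₁)) ⟩
      sumTo k (λ x₁ → sumTo k (λ x₂ → scal k 1# * ([ solution? x₁ x₂ ] * phase x₁ x₂)))
        ≈⟨ sumTo-cong k (λ x₁ → *-distribˡ-sumTo k (scal k 1#) _) ⟨
      sumTo k (λ x₁ → scal k 1# * sumTo k (λ x₂ → [ solution? x₁ x₂ ] * phase x₁ x₂))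
        ≈⟨ *-distribˡ-sumTo k (scal k 1#) _ ⟨
      scal k 1# * solutionSum
        ∎

    kloostermanPhase : ℕ → ℕ → ℕ → ℤ
    kloostermanPhase i x y = + suc i ℤ.* ᾱ (suc i) ℤ.* + x ℤ.* p₁ ℤ.+ p₃ /ℕ suc i ℤ.* + y ℤ.* p₂

    phase-φ : ∀ i x y j →
      phase (φ₁ i x) (φ₂ i y j) ≈ e (kloostermanPhase i x y) * e (+ (k / suc i) ℤ.* (+ j ℤ.* ℤ.- p₂))
    phase-φ i x y j = begin
      phase (φ₁ i x) (φ₂ i y j)
        ≈⟨ e-cong (+-cong-mod (-‿cong-mod (*-congʳ-mod p₁ (modN≡mod _ k)))
                              (-‿cong-mod (*-congʳ-mod p₂ (modN≡mod _ k)))) ⟩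
      e (ℤ.- (x₁-coord i (+ x) ℤ.* p₁) ℤ.- x₂-coord i (+ y) (+ j) ℤ.* p₂)
        ≡⟨ ≡.cong e (regroup (+ suc i) (ᾱ (suc i)) (+ x) p₁ (p₃ /ℕ suc i) (+ y) (+ j) (+ (k / suc i)) p₂)
         ⟩
      e (kloostermanPhase i x y ℤ.+ + (k / suc i) ℤ.* (+ j ℤ.* ℤ.- p₂))
        ≈⟨ e-+ (kloostermanPhase i x y) _ ⟩
      e (kloostermanPhase i x y) * e (+ (k / suc i) ℤ.* (+ j ℤ.* ℤ.- p₂))
        ∎
      where
      regroup : ∀ f ā x p₁ q₃ y j r p₂ →
        ℤ.- (ℤ.- (f ℤ.* ā ℤ.* x) ℤ.* p₁) ℤ.- (ℤ.- (q₃ ℤ.* y) ℤ.+ j ℤ.* r) ℤ.* p₂ ≡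
        (f ℤ.* ā ℤ.* x ℤ.* p₁ ℤ.+ q₃ ℤ.* y ℤ.* p₂) ℤ.+ r ℤ.* (j ℤ.* ℤ.- p₂)
      regroup = ℤ-Tactic.solve-∀

    parametrisedSum : ℕ → Carrier
    parametrisedSum i =
      sumTo (k / suc i) λ x → sumTo (k / suc i) λ y → sumTo (suc i) λ j →
        [ inverses? i x y ] * phase (φ₁ i x) (φ₂ i y j)

    kloostermanSum : ℕ → Carrier
    kloostermanSum i =
      sumTo (k / suc i) λ x → sumTo (k / suc i) λ y → [ inverses? i x y ] * e (kloostermanPhase i x y)

    parametrisedSum-factor : ∀ {i} → suc i ∣ k →
      parametrisedSum i ≈ kloostermanSum i * ([ suc i ∣? ∣ p₂ ∣ ] * scal (suc i) 1#)
    parametrisedSum-factor {i} f∣k = begin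
      parametrisedSum i
        ≈⟨ sumTo-cong r (λ x → sumTo-cong r (λ y → sumTo-cong f (λ j → separate x y j))) ⟩
      (sumTo r λ x → sumTo r λ y → sumTo f λ j → g x y * e′ (+ j ℤ.* ℤ.- p₂))
        ≈⟨ sumTo-cong r (λ x → sumTo-cong r (λ y → *-distribˡ-sumTo f (g x y) _)) ⟨
      (sumTo r λ x → sumTo r λ y → g x y * sumTo f (λ j → e′ (+ j ℤ.* ℤ.- p₂)))
        ≈⟨ sumTo-cong r (λ x → sumTo-cong r (λ y → *-congˡ (orthogonality′ (ℤ.- p₂)))) ⟩
      (sumTo r λ x → sumTo r λ y → g x y * ([ f ∣? ∣ ℤ.- p₂ ∣ ] * scal f 1#))
        ≡⟨ ≡.cong (λ n → sumTo r λ x → sumTo r λ y → g x y * ([ f ∣? n ] * scal f 1#)) (ℤ.∣-i∣≡∣i∣ p₂) ⟩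
      (sumTo r λ x → sumTo r λ y → g x y * ([ f ∣? ∣ p₂ ∣ ] * scal f 1#))
        ≈⟨ trans (*-distribʳ-sumTo r _ _) (sumTo-cong r (λ x → *-distribʳ-sumTo r _ _)) ⟨
      kloostermanSum i * ([ f ∣? ∣ p₂ ∣ ] * scal f 1#)
        ∎
      where
      open Divisor f∣k using (f; r; k≡f*r; r≢0)
      k≡r*f : k ≡ r ℕ.* f
      k≡r*f = ≡.trans k≡f*r (ℕ.*-comm f r)
      open Character no-zero-divisors f (pow ζ r) (pow-primitive r f k≡r*f ζ-primitive)
        using () renaming (e to e′; orthogonality to orthogonality′)
      g : ℕ → ℕ → Carrier
      g x y = [ inverses? i x y ] * e (kloostermanPhase i x y)
      separate : ∀ x y j → [ inverses? i x y ] * phase (φ₁ i x) (φ₂ i y j) ≈ g x y * e′ (+ j ℤ.* ℤ.- p₂)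
      separate x y j = begin
        [ inverses? i x y ] * phase (φ₁ i x) (φ₂ i y j)
          ≈⟨ *-congˡ (phase-φ i x y j) ⟩
        [ inverses? i x y ] * (e (kloostermanPhase i x y) * e (+ r ℤ.* (+ j ℤ.* ℤ.- p₂)))
          ≈⟨ *-assoc _ _ _ ⟨
        g x y * e (+ r ℤ.* (+ j ℤ.* ℤ.- p₂))
          ≈⟨ *-congˡ (ex-pow (proj₁ ζ-primitive) r f k≡r*f (+ j ℤ.* ℤ.- p₂)) ⟨
        g x y * e′ (+ j ℤ.* ℤ.- p₂)
          ∎

    kloosterman : ℕ → Carrier
    kloosterman i = Kloosterman (pow ζ (suc i)) (p₁ ℤ.* ᾱ (suc i)) ((p₂ ℤ.* p₃) /ℕ (suc i ℕ.* suc i)) (k / suc i)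

    kloosterman≈kloostermanSum : ∀ {i} → suc i ∣ k → suc i ∣ ∣ p₂ ∣ → suc i ∣ ∣ p₃ ∣ →
                                 kloosterman i ≈ kloostermanSum i
    kloosterman≈kloostermanSum {i} f∣k f∣p₂ f∣p₃ = sumTo-cong r (λ x → sumTo-cong r (λ y → summand x y))
      where
      open Divisor f∣k using (f; r; k≡f*r; r≢0; q₃)
      q₂ : ℤ
      q₂ = p₂ /ℕ f
      p₂≡q₂f : p₂ ≡ q₂ ℤ.* + f
      p₂≡q₂f = ∣⇒≡/ℕ* p₂ f∣p₂
      p₂p₃/f²≡q₂q₃ : (p₂ ℤ.* p₃) /ℕ (f ℕ.* f) ≡ q₂ ℤ.* q₃
      p₂p₃/f²≡q₂q₃ = ≡.trans (≡.cong (_/ℕ (f ℕ.* f)) p₂p₃≡q₂q₃f²) (*/ℕ-cancel (q₂ ℤ.* q₃))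
        where
        regroup : ∀ q₂ q₃ f → q₂ ℤ.* f ℤ.* (q₃ ℤ.* f) ≡ q₂ ℤ.* q₃ ℤ.* (f ℤ.* f)
        regroup = ℤ-Tactic.solve-∀
        p₂p₃≡q₂q₃f² : p₂ ℤ.* p₃ ≡ q₂ ℤ.* q₃ ℤ.* + (f ℕ.* f)
        p₂p₃≡q₂q₃f² = ≡.trans (≡.cong₂ ℤ._*_ p₂≡q₂f (∣⇒≡/ℕ* p₃ f∣p₃))
                        (≡.trans (regroup q₂ q₃ (+ f)) (≡.cong (q₂ ℤ.* q₃ ℤ.*_) (≡.sym (ℤ.pos-* f f))))
      regroup : ∀ f ā x p₁ q₂ q₃ y →
        f ℤ.* (p₁ ℤ.* ā ℤ.* x ℤ.+ q₂ ℤ.* q₃ ℤ.* y) ≡ f ℤ.* ā ℤ.* x ℤ.* p₁ ℤ.+ q₃ ℤ.* y ℤ.* (q₂ ℤ.* f)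
      regroup = ℤ-Tactic.solve-∀
      summand : ∀ x y →
        (if ⌊ inverses? i x y ⌋
         then ex (pow ζ f) r (p₁ ℤ.* ᾱ f ℤ.* + x ℤ.+ (p₂ ℤ.* p₃) /ℕ (f ℕ.* f) ℤ.* + y)
         else 0#)
        ≈ [ inverses? i x y ] * e (kloostermanPhase i x y)
      summand x y = trans (if-then-0≈[]* (inverses? i x y) _) (*-congˡ (begin
        ex (pow ζ f) r (p₁ ℤ.* ᾱ f ℤ.* + x ℤ.+ (p₂ ℤ.* p₃) /ℕ (f ℕ.* f) ℤ.* + y)
          ≈⟨ ex-pow (proj₁ ζ-primitive) f r k≡f*r _ ⟩
        e (+ f ℤ.* (p₁ ℤ.* ᾱ f ℤ.* + x ℤ.+ (p₂ ℤ.* p₃) /ℕ (f ℕ.* f) ℤ.* + y))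
          ≡⟨ ≡.cong (λ n → e (+ f ℤ.* (p₁ ℤ.* ᾱ f ℤ.* + x ℤ.+ n ℤ.* + y))) p₂p₃/f²≡q₂q₃ ⟩
        e (+ f ℤ.* (p₁ ℤ.* ᾱ f ℤ.* + x ℤ.+ q₂ ℤ.* q₃ ℤ.* + y))
          ≡⟨ ≡.cong e (regroup (+ f) (ᾱ f) (+ x) p₁ q₂ q₃ (+ y)) ⟩
        e (+ f ℤ.* ᾱ f ℤ.* + x ℤ.* p₁ ℤ.+ q₃ ℤ.* + y ℤ.* (q₂ ℤ.* + f))
          ≡⟨ ≡.cong (λ n → e (+ f ℤ.* ᾱ f ℤ.* + x ℤ.* p₁ ℤ.+ q₃ ℤ.* + y ℤ.* n)) p₂≡q₂f ⟨
        e (kloostermanPhase i x y)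
          ∎))

    kloostermanTerm : ℕ → Carrier
    kloostermanTerm i =
      if ⌊ (suc i ∣? ∣ p₂ ∣) ×-dec ((suc i ∣? ∣ p₃ ∣) ×-dec (suc i ∣? k)) ⌋
      then scal (suc i) (kloosterman i)
      else 0#

    kloostermanTerm≈parametrisedSum : ∀ i → kloostermanTerm i ≈ [ admissible? i ] * parametrisedSum i
    kloostermanTerm≈parametrisedSum i = by-cases (suc i ∣? ∣ p₂ ∣) (suc i ∣? ∣ p₃ ∣) (suc i ∣? k)
      where
      f : ℕ
      f = suc i
      factor≈ : ∀ c → f ∣ k → [ f ∣? ∣ p₂ ∣ ] ≈ c → kloostermanSum i * (c * scal f 1#) ≈ 1# * parametrisedSum i
      factor≈ c f∣k [f∣p₂]≈c = begin
        kloostermanSum i * (c * scal f 1#)                   ≈⟨ *-congˡ (*-congʳ [f∣p₂]≈c) ⟨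
        kloostermanSum i * ([ f ∣? ∣ p₂ ∣ ] * scal f 1#)     ≈⟨ parametrisedSum-factor f∣k ⟨
        parametrisedSum i                                    ≈⟨ *-identityˡ _ ⟨
        1# * parametrisedSum i                               ∎
      by-cases : (a : Dec (f ∣ ∣ p₂ ∣)) (b : Dec (f ∣ ∣ p₃ ∣)) (c : Dec (f ∣ k)) →
                 (if ⌊ a ×-dec (b ×-dec c) ⌋ then scal f (kloosterman i) else 0#) ≈
                 [ b ×-dec c ] * parametrisedSum i
      by-cases (yes f∣p₂) (yes f∣p₃) (yes f∣k) = begin
        scal f (kloosterman i)                   ≈⟨ scal≈scal1* f (kloosterman i) ⟩
        scal f 1# * kloosterman i                ≈⟨ *-congˡ (kloosterman≈kloostermanSum f∣k f∣p₂ f∣p₃) ⟩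
        scal f 1# * kloostermanSum i             ≈⟨ *-comm _ _ ⟩
        kloostermanSum i * scal f 1#             ≈⟨ *-congˡ (*-identityˡ _) ⟨
        kloostermanSum i * (1# * scal f 1#)      ≈⟨ factor≈ 1# f∣k ([]-yes (f ∣? ∣ p₂ ∣) f∣p₂) ⟩
        1# * parametrisedSum i                   ∎
      by-cases (no f∤p₂) (yes _) (yes f∣k) = begin
        0#                                       ≈⟨ zeroʳ _ ⟨
        kloostermanSum i * 0#                    ≈⟨ *-congˡ (zeroˡ _) ⟨
        kloostermanSum i * (0# * scal f 1#)      ≈⟨ factor≈ 0# f∣k ([]-no (f ∣? ∣ p₂ ∣) f∤p₂) ⟩
        1# * parametrisedSum i                   ∎
      by-cases (yes _) (yes _) (no _) = sym (zeroˡ _)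
      by-cases (no _)  (yes _) (no _) = sym (zeroˡ _)
      by-cases (yes _) (no _)  _      = sym (zeroˡ _)
      by-cases (no _)  (no _)  _      = sym (zeroˡ _)

    [parametrises?]≈ : ∀ i x y j x₁ x₂ → [ parametrises? i x y j x₁ x₂ ] ≈
      [ admissible? i ] * ([ inverses? i x y ] * ([ x₁ ℕ.≟ φ₁ i x ] * [ x₂ ℕ.≟ φ₂ i y j ]))
    [parametrises?]≈ i x y j x₁ x₂ =
      trans ([]-map′ (admissible? i ×-dec inverses? i x y ×-dec (x₁ ℕ.≟ φ₁ i x) ×-dec (x₂ ℕ.≟ φ₂ i y j)))
            (trans ([]-×-dec (admissible? i) _) (*-congˡ (trans ([]-×-dec (inverses? i x y) _)
                   (*-congˡ ([]-×-dec (x₁ ℕ.≟ φ₁ i x) (x₂ ℕ.≟ φ₂ i y j))))))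

    collapse : ∀ i x y j →
      [ admissible? i ] * ([ inverses? i x y ] * phase (φ₁ i x) (φ₂ i y j)) ≈
      sumTo k (λ x₁ → sumTo k (λ x₂ → [ parametrises? i x y j x₁ x₂ ] * phase x₁ x₂))
    collapse i x y j = sym (begin
      sumTo k (λ x₁ → sumTo k (λ x₂ → [ parametrises? i x y j x₁ x₂ ] * phase x₁ x₂))
        ≈⟨ sumTo-cong k (λ x₁ → sumTo-cong k (λ x₂ → separate x₁ x₂)) ⟩
      sumTo k (λ x₁ → sumTo k (λ x₂ → [ x₁ ℕ.≟ φ₁ i x ] * ([ x₂ ℕ.≟ φ₂ i y j ] * g x₁ x₂)))
        ≈⟨ sumTo-cong k (λ x₁ → *-distribˡ-sumTo k _ _) ⟨
      sumTo k (λ x₁ → [ x₁ ℕ.≟ φ₁ i x ] * sumTo k (λ x₂ → [ x₂ ℕ.≟ φ₂ i y j ] * g x₁ x₂))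
        ≈⟨ sumTo-cong k (λ x₁ → *-congˡ (sumTo-[≟]* k (g x₁) (modN-< _ k))) ⟩
      sumTo k (λ x₁ → [ x₁ ℕ.≟ φ₁ i x ] * g x₁ (φ₂ i y j))
        ≈⟨ sumTo-[≟]* k (λ x₁ → g x₁ (φ₂ i y j)) (modN-< _ k) ⟩
      g (φ₁ i x) (φ₂ i y j)
        ∎)
      where
      open Solver using (_:*_; _:=_)
      g : ℕ → ℕ → Carrier
      g x₁ x₂ = [ admissible? i ] * ([ inverses? i x y ] * phase x₁ x₂)
      separate : ∀ x₁ x₂ →
        [ parametrises? i x y j x₁ x₂ ] * phase x₁ x₂ ≈ [ x₁ ℕ.≟ φ₁ i x ] * ([ x₂ ℕ.≟ φ₂ i y j ] * g x₁ x₂)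
      separate x₁ x₂ = begin
        [ parametrises? i x y j x₁ x₂ ] * phase x₁ x₂
          ≈⟨ *-congʳ ([parametrises?]≈ i x y j x₁ x₂) ⟩
        [ admissible? i ] * ([ inverses? i x y ] * ([ x₁ ℕ.≟ φ₁ i x ] * [ x₂ ℕ.≟ φ₂ i y j ])) * phase x₁ x₂
          ≈⟨ Solver.solve 5 (λ a b c d p → a :* (b :* (c :* d)) :* p := c :* (d :* (a :* (b :* p))))
                            refl [ admissible? i ] [ inverses? i x y ] [ x₁ ℕ.≟ φ₁ i x ] [ x₂ ℕ.≟ φ₂ i y j ]
                            (phase x₁ x₂) ⟩
        [ x₁ ℕ.≟ φ₁ i x ] * ([ x₂ ℕ.≟ φ₂ i y j ] * g x₁ x₂)
          ∎

    sumParams : (ℕ → ℕ → ℕ → ℕ → Carrier) → Carrier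
    sumParams g =
      sumTo k λ i → sumTo (k / suc i) λ x → sumTo (k / suc i) λ y → sumTo (suc i) λ j → g i x y j

    sumParams-cong : ∀ {g h : ℕ → ℕ → ℕ → ℕ → Carrier} → (∀ i x y j → g i x y j ≈ h i x y j) →
                     sumParams g ≈ sumParams h
    sumParams-cong g≈h =
      sumTo-cong k λ i → sumTo-cong (k / suc i) λ x → sumTo-cong (k / suc i) λ y → sumTo-cong (suc i) (g≈h i x y)

    sumParams-comm : ∀ (g : ℕ → ℕ → ℕ → ℕ → ℕ → ℕ → Carrier) →
      sumParams (λ i x y j → sumTo k λ x₁ → sumTo k λ x₂ → g i x y j x₁ x₂) ≈
      sumTo k (λ x₁ → sumTo k λ x₂ → sumParams (λ i x y j → g i x y j x₁ x₂))
    sumParams-comm g =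
      trans (sumTo-cong k λ i →
              trans (sumTo-cong (k / suc i) λ x →
                      trans (sumTo-cong (k / suc i) λ y → sumTo-comm₂ (suc i) k k _)
                            (sumTo-comm₂ (k / suc i) k k _))
                    (sumTo-comm₂ (k / suc i) k k _))
            (sumTo-comm₂ k k k _)

    *-distribʳ-sumParams : ∀ g c → sumParams g * c ≈ sumParams (λ i x y j → g i x y j * c)
    *-distribʳ-sumParams g c =
      trans (*-distribʳ-sumTo k c _) (sumTo-cong k λ i →
      trans (*-distribʳ-sumTo (k / suc i) c _) (sumTo-cong (k / suc i) λ x →
      trans (*-distribʳ-sumTo (k / suc i) c _) (sumTo-cong (k / suc i) λ y →
      *-distribʳ-sumTo (suc i) c _)))

    fibreCount : ℕ → ℕ → Carrier
    fibreCount x₁ x₂ = sumParams λ i x y j → [ parametrises? i x y j x₁ x₂ ]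

    module _ {x₁ x₂ : ℕ} where

      count₃ : ℕ → ℕ → ℕ → Carrier
      count₃ i x y = sumTo (suc i) λ j → [ parametrises? i x y j x₁ x₂ ]

      count₂ : ℕ → ℕ → Carrier
      count₂ i x = sumTo (k / suc i) (count₃ i x)

      count₁ : ℕ → Carrier
      count₁ i = sumTo (k / suc i) (count₂ i)

      count₃≈0 : ∀ {i x y} → (∀ j → j ℕ.< suc i → ¬ Parametrises i x y j x₁ x₂) → count₃ i x y ≈ 0#
      count₃≈0 {i} {x} {y} ¬P = sumTo-zero (suc i) _ (λ j j<f → []-no (parametrises? i x y j x₁ x₂) (¬P j j<f))

      count₂≈0 : ∀ {i x} → (∀ y j → y ℕ.< k / suc i → j ℕ.< suc i → ¬ Parametrises i x y j x₁ x₂) →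
                 count₂ i x ≈ 0#
      count₂≈0 {i} ¬P = sumTo-zero (k / suc i) _ (λ y y<r → count₃≈0 (λ j → ¬P y j y<r))

      count₁≈0 : ∀ {i} → (∀ x y j → x ℕ.< k / suc i → y ℕ.< k / suc i → j ℕ.< suc i →
                                    ¬ Parametrises i x y j x₁ x₂) →
                 count₁ i ≈ 0#
      count₁≈0 {i} ¬P = sumTo-zero (k / suc i) _ (λ x x<r → count₂≈0 (λ y j → ¬P x y j x<r))

      fibreCount≈[solution?] : x₁ ℕ.< k → x₂ ℕ.< k → fibreCount x₁ x₂ ≈ [ solution? x₁ x₂ ]
      fibreCount≈[solution?] x₁<k x₂<k with solution? x₁ x₂
      ... | no ¬sol = sumTo-zero k _ (λ i _ → count₁≈0 (λ _ _ _ _ _ _ P → ¬sol (parametrises⇒Solution P)))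
      ... | yes sol = begin
        fibreCount x₁ x₂
          ≈⟨ sumTo-single k _ i<k (λ i′ _ i′≢i → count₁≈0 λ _ _ _ _ _ _ P →
                i′≢i (parametrises-divisor-unique P P₀)) ⟩
        count₁ i
          ≈⟨ sumTo-single (k / suc i) _ x<r (λ x′ x′<r x′≢x → count₂≈0 λ _ _ y′<r j′<f P →
                x′≢x (proj₁ (parametrises-unique P P₀ x′<r x<r y′<r y<r j′<f j<f))) ⟩
        count₂ i x
          ≈⟨ sumTo-single (k / suc i) _ y<r (λ y′ y′<r y′≢y → count₃≈0 λ _ j′<f P →
                y′≢y (proj₁ (proj₂ (parametrises-unique P P₀ x<r x<r y′<r y<r j′<f j<f)))) ⟩
        count₃ i x y
          ≈⟨ sumTo-single (suc i) _ j<f (λ j′ j′<f j′≢j → []-no (parametrises? i x y j′ x₁ x₂) λ P →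
                j′≢j (proj₂ (proj₂ (parametrises-unique P P₀ x<r x<r y<r y<r j′<f j<f)))) ⟩
        [ parametrises? i x y j x₁ x₂ ]
          ≈⟨ []-yes (parametrises? i x y j x₁ x₂) P₀ ⟩
        1#
          ∎
        where open Preimage (Solution⇒Preimage x₁<k x₂<k sol) renaming (parametrises to P₀)

    sumTo-kloostermanTerm≈solutionSum : sumTo k kloostermanTerm ≈ solutionSum
    sumTo-kloostermanTerm≈solutionSum = begin
      sumTo k kloostermanTerm
        ≈⟨ sumTo-cong k kloostermanTerm≈parametrisedSum ⟩
      sumTo k (λ i → [ admissible? i ] * parametrisedSum i)
        ≈⟨ sumTo-cong k distribute ⟩
      sumParams (λ i x y j → [ admissible? i ] * ([ inverses? i x y ] * phase (φ₁ i x) (φ₂ i y j)))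
        ≈⟨ sumParams-cong collapse ⟩
      sumParams (λ i x y j → sumTo k λ x₁ → sumTo k λ x₂ → [ parametrises? i x y j x₁ x₂ ] * phase x₁ x₂)
        ≈⟨ sumParams-comm _ ⟩
      sumTo k (λ x₁ → sumTo k λ x₂ → sumParams λ i x y j → [ parametrises? i x y j x₁ x₂ ] * phase x₁ x₂)
        ≈⟨ sumTo-cong k (λ x₁ → sumTo-cong k λ x₂ → *-distribʳ-sumParams _ (phase x₁ x₂)) ⟨
      sumTo k (λ x₁ → sumTo k λ x₂ → fibreCount x₁ x₂ * phase x₁ x₂)
        ≈⟨ sumTo-cong< k (λ x₁ x₁<k → sumTo-cong< k λ x₂ x₂<k → *-congʳ (fibreCount≈[solution?] x₁<k x₂<k)) ⟩
      solutionSum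
        ∎
      where
      distribute : ∀ i → [ admissible? i ] * parametrisedSum i ≈
        (sumTo (k / suc i) λ x → sumTo (k / suc i) λ y → sumTo (suc i) λ j →
           [ admissible? i ] * ([ inverses? i x y ] * phase (φ₁ i x) (φ₂ i y j)))
      distribute i =
        trans (*-distribˡ-sumTo (k / suc i) _ _) (sumTo-cong (k / suc i) λ x →
        trans (*-distribˡ-sumTo (k / suc i) _ _) (sumTo-cong (k / suc i) λ y →
        *-distribˡ-sumTo (suc i) _ _))

lemma8p2 : ∀ {c ℓ : Level} (R : CommutativeRing c ℓ) →
    let open Sums R in
    NoZeroDivisors → CharZero →
    (k : ℕ) → .{{_ : NonZero k}} → (ζ : Carrier) → PrimitiveRoot ζ k →
    (α : ℤ) → Coprime ∣ α ∣ k →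
    (p₁ p₂ p₃ : ℤ) →
    (abar : ℕ → ℤ) →
    (∀ i → suc i ∣ k → modN (α ℤ.* abar (suc i)) (k / suc i) ≡ modN (+ 1) (k / suc i)) →
    Asum ζ p₁ p₂ p₃ α k ≈ RHS ζ p₁ p₂ p₃ abar k
lemma8p2 R no-zero-divisors _ k ζ ζ-primitive α _ p₁ p₂ p₃ ᾱ ᾱ-inverse = begin
  Asum ζ p₁ p₂ p₃ α k                  ≈⟨ Asum≈k·solutionSum ⟩
  scal k 1# * solutionSum              ≈⟨ *-congˡ sumTo-kloostermanTerm≈solutionSum ⟨
  scal k 1# * sumTo k kloostermanTerm  ≈⟨ scal≈scal1* k _ ⟨
  RHS ζ p₁ p₂ p₃ ᾱ k                   ∎
  where
  open Sums R
  open CommutativeRing R using (1#; _*_; *-congˡ)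
  open CharacterSums R
  open Evaluation no-zero-divisors k ζ ζ-primitive α p₁ p₂ p₃ ᾱ ᾱ-inverse
  open import Relation.Binary.Reasoning.Setoid (CommutativeRing.setoid R)
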